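{- (i) For all positive integers $q,k$ there exists an integer $N\leq (1+q)^k$ such that for every $n\geq N$ and all positive integers $b_1\leq\ldots\leq b_n$ with $\frac1N\sum_{i=1}^N b_i\leq k$, Enforcer has a winning strategy in monotone-$mBox(b_1,\ldots,b_n,(1,q))$, both as the first and as the second player. (ii) For all positive integers $p,k$ there exists an integer $N\leq 1+e^{k/p}$ such that for every $n\geq N$ and all positive integers $b_1\leq\ldots\leq b_n$ with $\frac1N\sum_{i=1}^N b_i\leq k$, Enforcer has a winning strategy in monotone-$mBox(b_1,\ldots,b_n,(p,1))$, both as the first and as the second player.
   Context: In a $(p,q)$ Avoider-Enforcer game on a finite board $X$ with target family $\mathcal F\subseteq 2^X$ played according to the monotone rules, Avoider and Enforcer alternately claim at least $p$ and at least $q$ previously unclaimed elements of $X$ per move, respectively; if fewer than $p$ (resp. $q$) unclaimed elements remain before Avoider's (resp. Enforcer's) move, he claims all of them. It is specified which player moves first. The game ends when all elements are claimed; Avoider loses (Enforcer wins) if at the end Avoider has claimed all elements of some target set, otherwise Avoider wins. The game monotone-$mBox(b_1,\ldots,b_n,(p,q))$ is this game (monotone rules) on the board consisting of the disjoint union of pairwise disjoint sets (boxes) $B_1,\ldots,B_n$ with $|B_i|=b_i$, with target sets exactly $B_1,\ldots,B_n$. -}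

module Defs where

open import Data.Nat using (ℕ; zero; suc; _+_; _*_; _∸_; _^_; _≤_; _<_; _!; _<ᵇ_)

open import Data.Fin using (Fin; toℕ) renaming (zero to fzero; suc to fsuc)
open import Data.Bool using (Bool; true; false; if_then_else_)
open import Data.Product using (Σ; ∃; _×_; _,_)
open import Data.Sum using (_⊎_)
open import Relation.Nullary using (¬_)
open import Relation.Binary.PropositionalEquality using (_≡_)

ΣF : (m : ℕ) → (Fin m → ℕ) → ℕ
ΣF zero    f = 0
ΣF (suc m) f = f fzero + ΣF m (λ i → f (fsuc i))

-- sum of the first N entries of b : Fin n → ℕ  (b_1 + ... + b_N, 0-indexed here)
sumFirst : ∀ {n} → ℕ → (Fin n → ℕ) → ℕ
sumFirst {n} N b = ΣF n (λ i → if toℕ i <ᵇ N then b i else 0)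

Sorted : ∀ {n} → (Fin n → ℕ) → Set
Sorted {n} b = (i j : Fin n) → toℕ i ≤ toℕ j → b i ≤ b j

-- Partial sums of the exponential series, scaled by t!:
--   expS k t = Σ_{j=0}^{t} k^j * t!/j!     (so expS k t / t! = Σ_{j≤t} k^j/j!)
expS : ℕ → ℕ → ℕ
expS k zero    = 1
expS k (suc t) = suc t * expS k t + k ^ suc t

-- m ≤ e^k  (real inequality), expressed exactly:
--   for every d ≥ 1 there is t with  m - 1/d < Σ_{j≤t} k^j/j!,
--   i.e.  m * d * t! < d * expS k t + t!
-- (e^k is the supremum of the strictly increasing partial sums).
LeExp : ℕ → ℕ → Set
LeExp m k = (d : ℕ) → 1 ≤ d → ∃ λ t → m * d * (t !) < d * expS k t + t !

-- N ≤ 1 + e^{k/p}  (for p ≥ 1) :  N ≤ 1, or (N-1)^p ≤ e^k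
LeOnePlusExp : (N k p : ℕ) → Set
LeOnePlusExp N k p = N ≤ 1 ⊎ LeExp ((N ∸ 1) ^ p) k

-- The monotone box game  monotone-mBox(b_1,...,b_n,(p,q))
-- Board: element (i , j) with i : Fin n, j : Fin (b i); box B_i = {(i , j)}.

data Cell : Set where
  free avd enf : Cell

data Player : Set where
  avoider enforcer : Player

module BoxGame {n : ℕ} (b : Fin n → ℕ) (p q : ℕ) where

  State : Set
  State = (i : Fin n) → Fin (b i) → Cell

  initial : State
  initial _ _ = free

  Move : Set
  Move = (i : Fin n) → Fin (b i) → Bool

  size : Move → ℕ
  size M = ΣF n (λ i → ΣF (b i) (λ j → if M i j then 1 else 0))

  -- legal move under monotone rules with lower bound r:
  -- only unclaimed elements, and at least r of them, or all remaining ones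
  -- (the latter is forced when fewer than r remain)
  Legal : ℕ → State → Move → Set
  Legal r s M = ((i : Fin n) (j : Fin (b i)) → M i j ≡ true → s i j ≡ free)
              × (r ≤ size M ⊎ ((i : Fin n) (j : Fin (b i)) → s i j ≡ free → M i j ≡ true))

  play : Cell → State → Move → State
  play c s M i j = if M i j then c else s i j

  Finished : State → Set
  Finished s = (i : Fin n) (j : Fin (b i)) → ¬ (s i j ≡ free)

  AvoiderLost : State → Set
  AvoiderLost s = Σ (Fin n) λ i → (j : Fin (b i)) → s i j ≡ avd

  -- EWins t s : Enforcer has a winning strategy from position s
  -- with player t to move (inductive = finite game tree).
  data EWins : Player → State → Set where
    over      : ∀ {t s} → Finished s → AvoiderLost s → EWins t s
    avdMoves  : ∀ {s} → ¬ Finished s →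
                ((M : Move) → Legal p s M → EWins enforcer (play avd s M)) →
                EWins avoider s
    enfMoves  : ∀ {s} → ¬ Finished s →
                Σ Move (λ M → Legal q s M × EWins avoider (play enf s M)) →
                EWins enforcer s

  EnforcerWinsBoth : Set
  EnforcerWinsBoth = EWins enforcer initial × EWins avoider initial

EnforcerWinsBoth : ∀ {n} → (Fin n → ℕ) → ℕ → ℕ → Set
EnforcerWinsBoth b p q = BoxGame.EnforcerWinsBoth b p q

module Submission where

-- Both parts use one strategy (KillingStrategy): Enforcer keeps a set K of live boxes, none
-- containing an element of his, and after each Avoider move claims every free element outside
-- a smaller set K' ⊆ K.  If an invariant of K and the free counts can always be re-established
-- this way (a Plan), then at the end some live box belongs entirely to Avoider.

open import Defs
open import Data.Nat
  using (ℕ; zero; suc; _+_; _*_; _∸_; _^_; _≤_; _<_; _<ᵇ_; _!; _/_; z≤n; s≤s; NonZero; >-nonZero)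
open import Data.Nat.Properties
open import Data.Nat.Divisibility
  using (_∣_; m∣m*n; ∣-trans; m≤n⇒m!∣n!; n/m≡quotient; m∣n⇒n≡m*quotient)
open import Data.Nat.Tactic.RingSolver using (solve-∀)
open import Data.Fin using (Fin; toℕ; fromℕ<) renaming (zero to fzero; suc to fsuc)
open import Data.Fin.Properties using (any?; all?) renaming (_≟_ to _≟ᶠ_)
open import Data.Bool using (Bool; true; false; if_then_else_; _∧_; not)
open import Data.Product using (Σ; ∃; _×_; _,_; proj₁; proj₂)
open import Data.Sum using (_⊎_; inj₁; inj₂)
open import Data.Empty using (⊥; ⊥-elim)
open import Relation.Nullary using (¬_; Dec; yes; no; does)
open import Relation.Binary.PropositionalEquality

ΣF-cong : ∀ m {f g : Fin m → ℕ} → (∀ i → f i ≡ g i) → ΣF m f ≡ ΣF m g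
ΣF-cong zero    e = refl
ΣF-cong (suc m) e = cong₂ _+_ (e fzero) (ΣF-cong m (λ i → e (fsuc i)))

ΣF-mono : ∀ m {f g : Fin m → ℕ} → (∀ i → f i ≤ g i) → ΣF m f ≤ ΣF m g
ΣF-mono zero    e = z≤n
ΣF-mono (suc m) e = +-mono-≤ (e fzero) (ΣF-mono m (λ i → e (fsuc i)))

ΣF-strict : ∀ m {f g : Fin m → ℕ} → (∀ i → f i ≤ g i) → (i : Fin m) → f i < g i → ΣF m f < ΣF m g
ΣF-strict (suc m) e fzero    lt = +-mono-<-≤ lt (ΣF-mono m (λ i → e (fsuc i)))
ΣF-strict (suc m) e (fsuc i) lt = +-mono-≤-< (e fzero) (ΣF-strict m (λ j → e (fsuc j)) i lt)

ΣF-strict⁻¹ : ∀ m {f g : Fin m → ℕ} → (∀ i → f i ≤ g i) → ΣF m f < ΣF m g → Σ (Fin m) λ i → f i < g i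
ΣF-strict⁻¹ (suc m) {f} {g} le lt with f fzero <? g fzero
... | yes l = fzero , l
... | no nl with ΣF-strict⁻¹ m (λ i → le (fsuc i)) (+-cancelˡ-< (f fzero) _ _ tail<)
  where
  tail< : f fzero + ΣF m (λ i → f (fsuc i)) < f fzero + ΣF m (λ i → g (fsuc i))
  tail< = subst (λ z → f fzero + _ < z + _) (sym (≤-antisym (le fzero) (≮⇒≥ nl))) lt
... | i , fi<gi = fsuc i , fi<gi

ΣF-+ : ∀ m (f g : Fin m → ℕ) → ΣF m (λ i → f i + g i) ≡ ΣF m f + ΣF m g
ΣF-+ zero    f g = refl
ΣF-+ (suc m) f g rewrite ΣF-+ m (λ i → f (fsuc i)) (λ i → g (fsuc i)) =
  interchange (f fzero) (g fzero) _ _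
  where
  interchange : ∀ a b c d → a + b + (c + d) ≡ a + c + (b + d)
  interchange = solve-∀

ΣF-* : ∀ m c (f : Fin m → ℕ) → ΣF m (λ i → c * f i) ≡ c * ΣF m f
ΣF-* zero    c f = sym (*-zeroʳ c)
ΣF-* (suc m) c f rewrite ΣF-* m c (λ i → f (fsuc i)) = sym (*-distribˡ-+ c (f fzero) _)

ΣF-ones : ∀ m → ΣF m (λ _ → 1) ≡ m
ΣF-ones zero    = refl
ΣF-ones (suc m) = cong suc (ΣF-ones m)

ΣF-zero : ∀ m {f : Fin m → ℕ} → (∀ i → f i ≡ 0) → ΣF m f ≡ 0
ΣF-zero zero    e = refl
ΣF-zero (suc m) e rewrite e fzero = ΣF-zero m (λ i → e (fsuc i))

ΣF-zero⁻¹ : ∀ m {f : Fin m → ℕ} → ΣF m f ≡ 0 → ∀ i → f i ≡ 0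
ΣF-zero⁻¹ (suc m) {f} e fzero    = m+n≡0⇒m≡0 (f fzero) e
ΣF-zero⁻¹ (suc m) {f} e (fsuc i) = ΣF-zero⁻¹ m (m+n≡0⇒n≡0 (f fzero) e) i

ΣF-term≤ : ∀ m (f : Fin m → ℕ) (i : Fin m) → f i ≤ ΣF m f
ΣF-term≤ (suc m) f fzero    = m≤m+n (f fzero) _
ΣF-term≤ (suc m) f (fsuc i) = ≤-trans (ΣF-term≤ m (λ i → f (fsuc i)) i) (m≤n+m _ (f fzero))

ΣF-pos : ∀ m (f : Fin m → ℕ) → 1 ≤ ΣF m f → Σ (Fin m) λ i → 1 ≤ f i
ΣF-pos (suc m) f h with f fzero in eq
... | suc _ = fzero , subst (1 ≤_) (sym eq) (s≤s z≤n)
... | zero with ΣF-pos m (λ i → f (fsuc i)) h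
... | i , hi = fsuc i , hi

ΣF-≤-const : ∀ m (f : Fin m → ℕ) c → (∀ i → f i ≤ c) → ΣF m f ≤ m * c
ΣF-≤-const zero    f c e = z≤n
ΣF-≤-const (suc m) f c e = +-mono-≤ (e fzero) (ΣF-≤-const m (λ i → f (fsuc i)) c (λ i → e (fsuc i)))

ΣF-split : ∀ m (f : Fin m → ℕ) (i₀ : Fin m) →
  ΣF m f ≡ f i₀ + ΣF m (λ i → if does (i ≟ᶠ i₀) then 0 else f i)
ΣF-split (suc m) f fzero     = refl
ΣF-split (suc m) f (fsuc i₀) rewrite ΣF-split m (λ i → f (fsuc i)) i₀ = swap (f fzero) (f (fsuc i₀)) _
  where
  swap : ∀ a b c → a + (b + c) ≡ b + (a + c)
  swap = solve-∀

Mask : ℕ → Set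
Mask m = Fin m → Bool

_⊆_ : ∀ {m} → Mask m → Mask m → Set
K ⊆ L = ∀ i → K i ≡ true → L i ≡ true

sumOn : ∀ {m} → Mask m → (Fin m → ℕ) → ℕ
sumOn {m} K g = ΣF m (λ i → if K i then g i else 0)

sumOff : ∀ {m} → Mask m → (Fin m → ℕ) → ℕ
sumOff {m} K g = ΣF m (λ i → if K i then 0 else g i)

card : ∀ {m} → Mask m → ℕ
card K = sumOn K (λ _ → 1)

remove : ∀ {m} → Mask m → Fin m → Mask m
remove K i₀ i = K i ∧ not (does (i ≟ᶠ i₀))

remove-⊆ : ∀ {m} (K : Mask m) (i₀ : Fin m) → remove K i₀ ⊆ K
remove-⊆ K i₀ i h with K i
... | true  = refl
... | false = h

module _ {m : ℕ} where

  sumOn-cong : (K : Mask m) {g h : Fin m → ℕ} → (∀ i → K i ≡ true → g i ≡ h i) → sumOn K g ≡ sumOn K h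
  sumOn-cong K {g} {h} e = ΣF-cong m termwise
    where
    termwise : ∀ i → (if K i then g i else 0) ≡ (if K i then h i else 0)
    termwise i with K i in Ki
    ... | true  = e i Ki
    ... | false = refl

  sumOn-mono : (K : Mask m) {g h : Fin m → ℕ} → (∀ i → K i ≡ true → g i ≤ h i) → sumOn K g ≤ sumOn K h
  sumOn-mono K {g} {h} le = ΣF-mono m termwise
    where
    termwise : ∀ i → (if K i then g i else 0) ≤ (if K i then h i else 0)
    termwise i with K i in Ki
    ... | true  = le i Ki
    ... | false = z≤n

  sumOn-strict : (K : Mask m) {g h : Fin m → ℕ} → (∀ i → K i ≡ true → g i ≤ h i) →
    ∀ i → K i ≡ true → g i < h i → sumOn K g < sumOn K h
  sumOn-strict K {g} {h} le i Ki lt = ΣF-strict m termwise i strictAt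
    where
    termwise : ∀ i → (if K i then g i else 0) ≤ (if K i then h i else 0)
    termwise i with K i in Kj
    ... | true  = le i Kj
    ... | false = z≤n
    strictAt : (if K i then g i else 0) < (if K i then h i else 0)
    strictAt rewrite Ki = lt

  sumOn-+ : (K : Mask m) (g h : Fin m → ℕ) → sumOn K (λ i → g i + h i) ≡ sumOn K g + sumOn K h
  sumOn-+ K g h = trans (ΣF-cong m termwise) (ΣF-+ m _ _)
    where
    termwise : ∀ i → (if K i then g i + h i else 0) ≡ (if K i then g i else 0) + (if K i then h i else 0)
    termwise i with K i
    ... | true  = refl
    ... | false = refl

  sumOn-* : (K : Mask m) (c : ℕ) (h : Fin m → ℕ) → sumOn K (λ i → c * h i) ≡ c * sumOn K h
  sumOn-* K c h = trans (ΣF-cong m termwise) (ΣF-* m c _)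
    where
    termwise : ∀ i → (if K i then c * h i else 0) ≡ c * (if K i then h i else 0)
    termwise i with K i
    ... | true  = refl
    ... | false = sym (*-zeroʳ c)

  sumOn-all : (K : Mask m) (f : Fin m → ℕ) → (∀ i → K i ≡ false → f i ≡ 0) → sumOn K f ≡ ΣF m f
  sumOn-all K f e = ΣF-cong m termwise
    where
    termwise : ∀ i → (if K i then f i else 0) ≡ f i
    termwise i with K i in Ki
    ... | true  = refl
    ... | false = sym (e i Ki)

  sumOn-remove : (K : Mask m) (g : Fin m → ℕ) (i₀ : Fin m) → K i₀ ≡ true → sumOn K g ≡ g i₀ + sumOn (remove K i₀) g
  sumOn-remove K g i₀ Ki₀ =
    trans (ΣF-split m _ i₀) (cong₂ _+_ (cong (λ z → if z then g i₀ else 0) Ki₀) (ΣF-cong m termwise))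
    where
    termwise : ∀ i → (if does (i ≟ᶠ i₀) then 0 else (if K i then g i else 0)) ≡ (if remove K i₀ i then g i else 0)
    termwise i with does (i ≟ᶠ i₀) | K i
    ... | true  | true  = refl
    ... | true  | false = refl
    ... | false | true  = refl
    ... | false | false = refl

  card-remove : (K : Mask m) (i₀ : Fin m) → K i₀ ≡ true → card K ≡ suc (card (remove K i₀))
  card-remove K i₀ = sumOn-remove K (λ _ → 1) i₀

  sumOn-⊆ : (K L : Mask m) (f : Fin m → ℕ) → L ⊆ K → sumOn K f ≤ sumOff L f + sumOn L f
  sumOn-⊆ K L f L⊆K = ≤-trans (ΣF-mono m termwise) (≤-reflexive (ΣF-+ m _ _))
    where
    termwise : ∀ i → (if K i then f i else 0) ≤ (if L i then 0 else f i) + (if L i then f i else 0)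
    termwise i with L i in Li
    ... | true rewrite L⊆K i Li = ≤-refl
    ... | false with K i
    ... | true  = m≤m+n (f i) 0
    ... | false = z≤n

  card*≤sumOn : (K : Mask m) (g : Fin m → ℕ) (c : ℕ) → (∀ i → K i ≡ true → c ≤ g i) → card K * c ≤ sumOn K g
  card*≤sumOn K g c le = ≤-trans (≤-reflexive (trans (*-comm (card K) c) (sym (ΣF-* m c _)))) (ΣF-mono m termwise)
    where
    termwise : ∀ i → c * (if K i then 1 else 0) ≤ (if K i then g i else 0)
    termwise i with K i in Ki
    ... | true  = ≤-trans (≤-reflexive (*-identityʳ c)) (le i Ki)
    ... | false = ≤-reflexive (*-zeroʳ c)

  sumOn≤card* : (K : Mask m) (g : Fin m → ℕ) (c : ℕ) → (∀ i → K i ≡ true → g i ≤ c) → sumOn K g ≤ card K * c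
  sumOn≤card* K g c le = ≤-trans (ΣF-mono m termwise) (≤-reflexive (trans (ΣF-* m c _) (*-comm c (card K))))
    where
    termwise : ∀ i → (if K i then g i else 0) ≤ c * (if K i then 1 else 0)
    termwise i with K i in Ki
    ... | true  = ≤-trans (le i Ki) (≤-reflexive (sym (*-identityʳ c)))
    ... | false = z≤n

  card-pos : (K : Mask m) → 1 ≤ card K → Σ (Fin m) λ i → K i ≡ true
  card-pos K h with ΣF-pos m _ h
  ... | i , hi with K i in Ki
  ... | true  = i , Ki
  ... | false = ⊥-elim (1≰0 hi)
    where
    1≰0 : ¬ (1 ≤ 0)
    1≰0 ()

  sumOn-single : (K : Mask m) (h : Fin m → ℕ) (i : Fin m) → card K ≡ 1 → K i ≡ true → sumOn K h ≡ h i
  sumOn-single K h i c1 Ki = trans (sumOn-remove K h i Ki) (trans (cong (h i +_) restEmpty) (+-identityʳ (h i)))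
    where
    cardRest : card (remove K i) ≡ 0
    cardRest = suc-injective (trans (sym (card-remove K i Ki)) c1)
    offRest : ∀ j → remove K i j ≡ false
    offRest j with remove K i j in Rj | ΣF-zero⁻¹ m cardRest j
    ... | false | _ = refl
    ... | true  | ()
    restEmpty : sumOn (remove K i) h ≡ 0
    restEmpty = ΣF-zero m (λ j → cong (λ z → if z then h j else 0) (offRest j))

argmax : ∀ {m} (K : Mask m) (f : Fin m → ℕ) → 1 ≤ card K →
  Σ (Fin m) λ i → K i ≡ true × (∀ j → K j ≡ true → f j ≤ f i)
argmax {suc m} K f h with 1 ≤? card {m} (λ i → K (fsuc i)) | K fzero in K0
... | no tailEmpty | true  = fzero , K0 , atHead
  where
  atHead : ∀ j → K j ≡ true → f j ≤ f fzero
  atHead fzero    _  = ≤-refl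
  atHead (fsuc j) Kj = ⊥-elim (tailEmpty (≤-trans (≤-reflexive (cong (λ z → if z then 1 else 0) (sym Kj)))
                                                   (ΣF-term≤ m (λ i → if K (fsuc i) then 1 else 0) j)))
... | no tailEmpty | false = ⊥-elim (tailEmpty h)
... | yes tailNonempty | K0b with argmax (λ i → K (fsuc i)) (λ i → f (fsuc i)) tailNonempty
...   | i , Ki , maxTail with K0b | f fzero ≤? f (fsuc i)
...     | false | _ = fsuc i , Ki , inTail
  where
  inTail : ∀ j → K j ≡ true → f j ≤ f (fsuc i)
  inTail fzero    Kj = ⊥-elim (false≢true (trans (sym K0) Kj))
    where
    false≢true : ¬ (false ≡ true)
    false≢true ()
  inTail (fsuc j) Kj = maxTail j Kj
...     | true | yes head≤ = fsuc i , Ki , inTail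
  where
  inTail : ∀ j → K j ≡ true → f j ≤ f (fsuc i)
  inTail fzero    _  = head≤
  inTail (fsuc j) Kj = maxTail j Kj
...     | true | no head≰ = fzero , K0 , atHead
  where
  atHead : ∀ j → K j ≡ true → f j ≤ f fzero
  atHead fzero    _  = ≤-refl
  atHead (fsuc j) Kj = ≤-trans (maxTail j Kj) (<⇒≤ (≰⇒> head≰))

-- Removing the r largest values of f from K leaves the set  kept ; a threshold value
-- separates the two parts, so bounds on the removed part only depend on f ≥ threshold.
record TopSplit {m} (r : ℕ) (K : Mask m) (f : Fin m → ℕ) : Set where
  field
    kept       : Mask m
    kept⊆K     : kept ⊆ K
    card-split : card K ≡ r + card kept
    threshold  : ℕ
    attained   : Σ (Fin m) λ i → K i ≡ true × f i ≡ threshold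
    kept-below : ∀ i → kept i ≡ true → f i ≤ threshold
    removed-lower : ∀ (h : Fin m → ℕ) c → (∀ i → K i ≡ true → threshold ≤ f i → c ≤ h i) →
                    r * c + sumOn kept h ≤ sumOn K h
    removed-upper : ∀ (h : Fin m → ℕ) c → (∀ i → K i ≡ true → threshold ≤ f i → h i ≤ c) →
                    sumOn K h ≤ r * c + sumOn kept h

module RemoveMax {m} (K : Mask m) (f : Fin m → ℕ) (nonempty : 1 ≤ card K) where
  top = argmax K f nonempty
  i₀  = proj₁ top
  Ki₀ = proj₁ (proj₂ top)
  rest : Mask m
  rest = remove K i₀
  max : ∀ j → K j ≡ true → f j ≤ f i₀
  max = proj₂ (proj₂ top)
  peel : ∀ h → sumOn K h ≡ h i₀ + sumOn rest h
  peel h = sumOn-remove K h i₀ Ki₀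
  card-rest : card K ≡ suc (card rest)
  card-rest = card-remove K i₀ Ki₀

topSplit⁺ : ∀ {m} r (K : Mask m) (f : Fin m → ℕ) → suc r ≤ card K → TopSplit (suc r) K f
topSplit⁺ zero K f 1≤card = record
  { kept          = rest
  ; kept⊆K        = remove-⊆ K i₀
  ; card-split    = card-rest
  ; threshold     = f i₀
  ; attained      = i₀ , Ki₀ , refl
  ; kept-below    = λ i ki → max i (remove-⊆ K i₀ i ki)
  ; removed-lower = λ h c bound → ≤-trans (+-monoˡ-≤ (sumOn rest h) (≤-trans (≤-reflexive (*-identityˡ c))
                                             (bound i₀ Ki₀ ≤-refl)))
                                           (≤-reflexive (sym (peel h)))
  ; removed-upper = λ h c bound → ≤-trans (≤-reflexive (peel h))
                                     (+-monoˡ-≤ (sumOn rest h) (≤-trans (bound i₀ Ki₀ ≤-refl)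
                                                                 (≤-reflexive (sym (*-identityˡ c)))))
  }
  where open RemoveMax K f 1≤card
topSplit⁺ (suc r) K f r<card = record
  { kept          = R.kept
  ; kept⊆K        = λ i ki → remove-⊆ K i₀ i (R.kept⊆K i ki)
  ; card-split    = trans card-rest (cong suc R.card-split)
  ; threshold     = R.threshold
  ; attained      = j , remove-⊆ K i₀ j restj , fj
  ; kept-below    = R.kept-below
  ; removed-lower = λ h c bound → begin
      suc (suc r) * c + sumOn R.kept h    ≡⟨ +-assoc c (suc r * c) _ ⟩
      c + (suc r * c + sumOn R.kept h)    ≤⟨ +-mono-≤ (bound i₀ Ki₀ threshold≤top)
                                               (R.removed-lower h c (λ i ri → bound i (remove-⊆ K i₀ i ri))) ⟩
      h i₀ + sumOn rest h                 ≡⟨ sym (peel h) ⟩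
      sumOn K h                           ∎
  ; removed-upper = λ h c bound → begin
      sumOn K h                           ≡⟨ peel h ⟩
      h i₀ + sumOn rest h                 ≤⟨ +-mono-≤ (bound i₀ Ki₀ threshold≤top)
                                               (R.removed-upper h c (λ i ri → bound i (remove-⊆ K i₀ i ri))) ⟩
      c + (suc r * c + sumOn R.kept h)    ≡⟨ sym (+-assoc c (suc r * c) _) ⟩
      suc (suc r) * c + sumOn R.kept h    ∎
  }
  where
  open RemoveMax K f (≤-trans (s≤s z≤n) r<card)
  open ≤-Reasoning
  module R = TopSplit (topSplit⁺ r rest f (≤-pred (subst (suc (suc r) ≤_) card-rest r<card)))
  j     = proj₁ R.attained
  restj = proj₁ (proj₂ R.attained)
  fj    = proj₂ (proj₂ R.attained)
  threshold≤top : R.threshold ≤ f i₀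
  threshold≤top = subst (_≤ f i₀) fj (max j (remove-⊆ K i₀ j restj))

topSplit : ∀ {m} r → 1 ≤ r → (K : Mask m) (f : Fin m → ℕ) → r ≤ card K → TopSplit r K f
topSplit (suc r) _ = topSplit⁺ r

removed-mass : ∀ {m r} {K : Mask m} {f : Fin m → ℕ} (split : TopSplit r K f) →
  (∀ i → K i ≡ true → 1 ≤ f i) → r ≤ sumOff (TopSplit.kept split) f
removed-mass {r = r} {K} {f} split pos =
  +-cancelʳ-≤ (sumOn kept f) r _
    (≤-trans (subst (λ z → z + sumOn kept f ≤ sumOn K f) (*-identityʳ r) (removed-lower f 1 (λ i Ki _ → pos i Ki)))
             (sumOn-⊆ K kept f kept⊆K))
  where open TopSplit split

kept-average : ∀ {m r} {K : Mask m} {f : Fin m → ℕ} (split : TopSplit r K f) →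
  card K * sumOn (TopSplit.kept split) f ≤ card (TopSplit.kept split) * sumOn K f
kept-average {r = r} {K} {f} split = begin
  card K * S                ≡⟨ cong (_* S) card-split ⟩
  (r + k) * S               ≡⟨ *-distribʳ-+ S r k ⟩
  r * S + k * S             ≤⟨ +-monoˡ-≤ (k * S) (*-monoʳ-≤ r (sumOn≤card* kept f threshold kept-below)) ⟩
  r * (k * threshold) + k * S ≡⟨ regroup r k threshold S ⟩
  k * (r * threshold + S)   ≤⟨ *-monoʳ-≤ k (removed-lower f threshold (λ _ _ t≤f → t≤f)) ⟩
  k * sumOn K f             ∎
  where
  open TopSplit split
  open ≤-Reasoning
  S = sumOn kept f
  k = card kept
  regroup : ∀ r k t S → r * (k * t) + k * S ≡ k * (r * t + S)
  regroup = solve-∀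

free? : Cell → Bool
free? free = true
free? avd  = false
free? enf  = false

_≟ᶜ_ : (x y : Cell) → Dec (x ≡ y)
free ≟ᶜ free = yes refl
free ≟ᶜ avd  = no (λ ())
free ≟ᶜ enf  = no (λ ())
avd  ≟ᶜ free = no (λ ())
avd  ≟ᶜ avd  = yes refl
avd  ≟ᶜ enf  = no (λ ())
enf  ≟ᶜ free = no (λ ())
enf  ≟ᶜ avd  = no (λ ())
enf  ≟ᶜ enf  = yes refl

module BoxGameFacts {n : ℕ} (b : Fin n → ℕ) (p q : ℕ) where
  open BoxGame b p q public

  freeIn : State → Fin n → ℕ
  freeIn s i = ΣF (b i) (λ j → if free? (s i j) then 1 else 0)

  freeTotal : State → ℕ
  freeTotal s = ΣF n (freeIn s)

  claimedIn : Move → Fin n → ℕ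
  claimedIn M i = ΣF (b i) (λ j → if M i j then 1 else 0)

  Fresh : State → Move → Set
  Fresh s M = ∀ i j → M i j ≡ true → s i j ≡ free

  claim-freeIn : ∀ c → free? c ≡ false → ∀ s M → Fresh s M →
    ∀ i → freeIn (play c s M) i + claimedIn M i ≡ freeIn s i
  claim-freeIn c c-taken s M fresh i =
    trans (sym (ΣF-+ (b i) _ _)) (ΣF-cong (b i) (λ j → element (M i j) (s i j) (fresh i j)))
    where
    element : (m : Bool) (x : Cell) → (m ≡ true → x ≡ free) →
      (if free? (if m then c else x) then 1 else 0) + (if m then 1 else 0) ≡ (if free? x then 1 else 0)
    element true  x h rewrite h refl | c-taken = refl
    element false x h = +-identityʳ _

  claim-freeTotal : ∀ c → free? c ≡ false → ∀ s M → Fresh s M → freeTotal (play c s M) + size M ≡ freeTotal s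
  claim-freeTotal c c-taken s M fresh = trans (sym (ΣF-+ n _ _)) (ΣF-cong n (claim-freeIn c c-taken s M fresh))

  claim-progress : ∀ c → free? c ≡ false → ∀ s M → Fresh s M → 1 ≤ size M →
    ∀ {k} → freeTotal s ≤ suc k → freeTotal (play c s M) ≤ k
  claim-progress c c-taken s M fresh pos {k} le = ≤-pred (begin
    suc (freeTotal (play c s M))   ≡⟨ +-comm 1 _ ⟩
    freeTotal (play c s M) + 1     ≤⟨ +-monoʳ-≤ _ pos ⟩
    freeTotal (play c s M) + size M ≡⟨ claim-freeTotal c c-taken s M fresh ⟩
    freeTotal s                    ≤⟨ le ⟩
    suc k                          ∎)
    where open ≤-Reasoning

  emptyBox : ∀ s i → freeIn s i ≡ 0 → ∀ j → ¬ (s i j ≡ free)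
  emptyBox s i e j sij with ΣF-zero⁻¹ (b i) e j
  ... | e′ rewrite sij = 1≢0 e′
    where
    1≢0 : ¬ (1 ≡ 0)
    1≢0 ()

  finished⇒empty : ∀ s → Finished s → freeTotal s ≡ 0
  finished⇒empty s fin = ΣF-zero n (λ i → ΣF-zero (b i) (λ j → taken (s i j) (fin i j)))
    where
    taken : ∀ x → ¬ (x ≡ free) → (if free? x then 1 else 0) ≡ 0
    taken free h = ⊥-elim (h refl)
    taken avd  h = refl
    taken enf  h = refl

  empty⇒finished : ∀ s → freeTotal s ≡ 0 → Finished s
  empty⇒finished s e i = emptyBox s i (ΣF-zero⁻¹ n e i)

  finished? : ∀ s → Dec (Finished s)
  finished? s with freeTotal s in e
  ... | zero  = yes (empty⇒finished s e)
  ... | suc _ = no (λ fin → suc≢0 (trans (sym e) (finished⇒empty s fin)))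
    where
    suc≢0 : ∀ {k} → ¬ (suc k ≡ 0)
    suc≢0 ()

  lost? : ∀ s → Dec (AvoiderLost s)
  lost? s = any? (λ i → all? (λ j → s i j ≟ᶜ avd))

  claimedElement : ∀ M → 1 ≤ size M → Σ (Fin n) λ i → Σ (Fin (b i)) λ j → M i j ≡ true
  claimedElement M h with ΣF-pos n _ h
  ... | i , hi with ΣF-pos (b i) _ hi
  ... | j , hj with M i j in Mij
  ... | true  = i , j , Mij
  ... | false = ⊥-elim (1≰0 hj)
    where
    1≰0 : ¬ (1 ≤ 0)
    1≰0 ()

  legal-progress : ∀ r s M → 1 ≤ r → ¬ Finished s → Legal r s M → 1 ≤ size M
  legal-progress r s M r≥1 unfinished (_ , inj₁ r≤size) = ≤-trans r≥1 r≤size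
  legal-progress r s M r≥1 unfinished (_ , inj₂ takesAll) with size M in e
  ... | suc _ = s≤s z≤n
  ... | zero  = ⊥-elim (unfinished (λ i j sij → notClaimed i j (takesAll i j sij)))
    where
    notClaimed : ∀ i j → ¬ (M i j ≡ true)
    notClaimed i j Mij with ΣF-zero⁻¹ (b i) (ΣF-zero⁻¹ n e i) j
    ... | e′ rewrite Mij = 1≢0 e′
      where
      1≢0 : ¬ (1 ≡ 0)
      1≢0 ()

  lost-persists : ∀ c s M → Fresh s M → AvoiderLost s → AvoiderLost (play c s M)
  lost-persists c s M fresh (i , owned) = i , kept
    where
    kept : ∀ j → play c s M i j ≡ avd
    kept j with M i j in Mij
    ... | false = owned j
    ... | true  = ⊥-elim (avd≢free (trans (sym (owned j)) (fresh i j Mij)))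
      where
      avd≢free : ¬ (avd ≡ free)
      avd≢free ()

  claimAll : State → Move
  claimAll s i j = free? (s i j)

  claimAll-legal : ∀ r s → Legal r s (claimAll s)
  claimAll-legal r s = fresh , inj₂ takesAll
    where
    fresh : Fresh s (claimAll s)
    fresh i j h with s i j
    ... | free = refl
    takesAll : ∀ i j → s i j ≡ free → claimAll s i j ≡ true
    takesAll i j sij rewrite sij = refl

  -- once Avoider has lost, Enforcer wins from any position (the game just runs out);
  -- this needs p ≥ 1 so that Avoider's moves make progress
  lostWins : 1 ≤ p → ∀ k s → freeTotal s ≤ k → AvoiderLost s → (t : Player) → EWins t s
  lostWins p≥1 k s le lost t with finished? s
  lostWins p≥1 k       s le lost t        | yes fin = over fin lost
  lostWins p≥1 zero    s le lost t        | no unfinished = ⊥-elim (unfinished (empty⇒finished s (n≤0⇒n≡0 le)))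
  lostWins p≥1 (suc k) s le lost enforcer | no unfinished =
    enfMoves unfinished (claimAll s , legal ,
      lostWins p≥1 k _ (claim-progress enf refl s _ (proj₁ legal) (legal-progress 1 s _ ≤-refl unfinished (claimAll-legal 1 s)) le)
                       (lost-persists enf s _ (proj₁ legal) lost) avoider)
    where
    legal = claimAll-legal q s
  lostWins p≥1 (suc k) s le lost avoider | no unfinished = avdMoves unfinished λ M legal →
    lostWins p≥1 k _ (claim-progress avd refl s M (proj₁ legal) (legal-progress p s M p≥1 unfinished legal) le)
                     (lost-persists avd s M (proj₁ legal) lost) enforcer

-- the change of the free counts f ↦ f' (of the boxes of K) caused by one Avoider move
record AvoiderEffect {n} (p : ℕ) (K : Mask n) (f f' : Fin n → ℕ) : Set where
  field
    claimed       : ℕ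
    decreasing    : ∀ i → f' i ≤ f i
    conservation  : ΣF n f' + claimed ≡ ΣF n f
    progress      : 1 ≤ claimed
    enough        : p ≤ claimed ⊎ (∀ i → f' i ≡ 0)
    outside-empty : ∀ i → K i ≡ false → f i ≡ 0

-- Enforcer's answer to free counts f: a set K' ⊆ K satisfying the invariant P,
-- with at least q free elements outside it (which he will claim)
Reply : ∀ {n} (q : ℕ) (P : Mask n → (Fin n → ℕ) → Set) → Mask n → (Fin n → ℕ) → Set
Reply {n} q P K f = Σ (Mask n) λ K' → K' ⊆ K × q ≤ sumOff K' f × P K' f

module KillingStrategy {n : ℕ} (b : Fin n → ℕ) (p q : ℕ) (P : Mask n → (Fin n → ℕ) → Set) where
  open BoxGameFacts b p q

  record Plan : Set where
    field
      nonempty : ∀ K f → P K f → Σ (Fin n) λ i → K i ≡ true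
      respects : ∀ K f g → P K f → (∀ i → K i ≡ true → f i ≡ g i) → P K g
      opening  : ∀ f → (∀ i → f i ≤ b i) → (∀ i → 1 ≤ f i) → Reply q P (λ _ → true) f
      reply    : ∀ K f f' → P K f → AvoiderEffect p K f f' → (∀ i → K i ≡ true → 1 ≤ f' i) → Reply q P K f'

  Live : State → Mask n → Set
  Live s K = ∀ i → K i ≡ true → ∀ j → ¬ (s i j ≡ enf)

  Covers : State → Mask n → Set
  Covers s K = ∀ i j → s i j ≡ free → K i ≡ true

  freeIn≤b : ∀ s i → freeIn s i ≤ b i
  freeIn≤b s i = subst (freeIn s i ≤_) (*-identityʳ (b i)) (ΣF-≤-const (b i) _ 1 (λ j → atMostOne (s i j)))
    where
    atMostOne : ∀ x → (if free? x then 1 else 0) ≤ 1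
    atMostOne free = ≤-refl
    atMostOne avd  = z≤n
    atMostOne enf  = z≤n

  ownedBox : ∀ s i → (∀ j → ¬ (s i j ≡ free)) → (∀ j → ¬ (s i j ≡ enf)) → AvoiderLost s
  ownedBox s i noFree noEnf = i , owned
    where
    owned : ∀ j → s i j ≡ avd
    owned j with s i j in sij
    ... | free = ⊥-elim (noFree j sij)
    ... | avd  = refl
    ... | enf  = ⊥-elim (noEnf j sij)

  liveBox-free : ∀ s → ¬ AvoiderLost s → ∀ i → (∀ j → ¬ (s i j ≡ enf)) → 1 ≤ freeIn s i
  liveBox-free s notLost i noEnf with freeIn s i in e
  ... | suc _ = s≤s z≤n
  ... | zero  = ⊥-elim (notLost (ownedBox s i (emptyBox s i e) noEnf))

  kill : State → Mask n → Move
  kill s K i j = free? (s i j) ∧ not (K i)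

  module _ (s : State) (K : Mask n) where

    kill-fresh : Fresh s (kill s K)
    kill-fresh i j h with s i j
    ... | free = refl
    kill-fresh i j () | avd
    kill-fresh i j () | enf

    kill-size : size (kill s K) ≡ sumOff K (freeIn s)
    kill-size = ΣF-cong n claimedBox
      where
      claimedBox : ∀ i → claimedIn (kill s K) i ≡ (if K i then 0 else freeIn s i)
      claimedBox i with K i
      ... | true  = ΣF-zero (b i) (λ j → cong (λ z → if z then 1 else 0) (x∧false (free? (s i j))))
        where
        x∧false : ∀ x → x ∧ false ≡ false
        x∧false true  = refl
        x∧false false = refl
      ... | false = ΣF-cong (b i) (λ j → cong (λ z → if z then 1 else 0) (x∧true (free? (s i j))))
        where
        x∧true : ∀ x → x ∧ true ≡ x
        x∧true true  = refl
        x∧true false = refl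

    kill-inside : ∀ i → K i ≡ true → ∀ j → play enf s (kill s K) i j ≡ s i j
    kill-inside i Ki j with free? (s i j)
    ... | false = refl
    ... | true rewrite Ki = refl

    kill-covers : Covers (play enf s (kill s K)) K
    kill-covers i j h with K i in Ki
    ... | true = refl
    ... | false with s i j in sij
    ... | free = ⊥-elim (enf≢free h)
      where
      enf≢free : ¬ (enf ≡ free)
      enf≢free ()
    kill-covers i j () | false | avd
    kill-covers i j () | false | enf

    kill-live : Live s K → Live (play enf s (kill s K)) K
    kill-live live i Ki j = subst (λ x → ¬ (x ≡ enf)) (sym (kill-inside i Ki j)) (live i Ki j)

    kill-freeIn : ∀ i → K i ≡ true → freeIn s i ≡ freeIn (play enf s (kill s K)) i
    kill-freeIn i Ki = ΣF-cong (b i) (λ j → cong (λ x → if free? x then 1 else 0) (sym (kill-inside i Ki j)))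

  module _ (s : State) (M : Move) where

    avoider-live : ∀ K → Live s K → Live (play avd s M) K
    avoider-live K live i Ki j h with M i j
    avoider-live K live i Ki j () | true
    ... | false = live i Ki j h

    avoider-effect : 1 ≤ p → ¬ Finished s → ∀ K → Covers s K → Legal p s M →
      AvoiderEffect p K (freeIn s) (freeIn (play avd s M))
    avoider-effect p≥1 unfinished K covers legal = record
      { claimed       = size M
      ; decreasing    = λ i → ≤-trans (m≤m+n _ (claimedIn M i)) (≤-reflexive (claim-freeIn avd refl s M fresh i))
      ; conservation  = claim-freeTotal avd refl s M fresh
      ; progress      = legal-progress p s M p≥1 unfinished legal
      ; enough        = enough (proj₂ legal)
      ; outside-empty = λ i Ki → ΣF-zero (b i) (λ j → notFree i Ki j)
      }
      where
      fresh = proj₁ legal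
      notFree : ∀ i → K i ≡ false → ∀ j → (if free? (s i j) then 1 else 0) ≡ 0
      notFree i Ki j with s i j in sij
      ... | free = ⊥-elim (false≢true (trans (sym Ki) (covers i j sij)))
        where
        false≢true : ¬ (false ≡ true)
        false≢true ()
      ... | avd = refl
      ... | enf = refl
      takenAfter : (∀ i j → s i j ≡ free → M i j ≡ true) → ∀ i j → (if free? (play avd s M i j) then 1 else 0) ≡ 0
      takenAfter takesAll i j with M i j in Mij
      ... | true = refl
      ... | false with s i j in sij
      ... | free = ⊥-elim (true≢false (trans (sym (takesAll i j sij)) Mij))
        where
        true≢false : ¬ (true ≡ false)
        true≢false ()
      ... | avd = refl
      ... | enf = refl
      enough : p ≤ size M ⊎ (∀ i j → s i j ≡ free → M i j ≡ true) → p ≤ size M ⊎ (∀ i → freeIn (play avd s M) i ≡ 0)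
      enough (inj₁ many)     = inj₁ many
      enough (inj₂ takesAll) = inj₂ (λ i → ΣF-zero (b i) (takenAfter takesAll i))

  -- Enforcer follows a plan; the recursion is on an upper bound for the number of free elements
  module Play (p≥1 : 1 ≤ p) (q≥1 : 1 ≤ q) (plan : Plan) where
    open Plan plan

    Invariant : State → Set
    Invariant s = Σ (Mask n) λ K → Covers s K × Live s K × P K (freeIn s)

    afterAvoider : ∀ k s → freeTotal s ≤ suc k → ¬ Finished s →
      (∀ M → Legal p s M → freeTotal (play avd s M) ≤ k → ¬ AvoiderLost (play avd s M) →
         EWins enforcer (play avd s M)) →
      EWins avoider s
    afterAvoider k s le unfinished continue = avdMoves unfinished answer
      where
      shrinks : ∀ M → Legal p s M → freeTotal (play avd s M) ≤ k
      shrinks M legal = claim-progress avd refl s M (proj₁ legal) (legal-progress p s M p≥1 unfinished legal) le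
      answer : ∀ M → Legal p s M → EWins enforcer (play avd s M)
      answer M legal with lost? (play avd s M)
      ... | yes lost    = lostWins p≥1 k _ (shrinks M legal) lost enforcer
      ... | no  notLost = continue M legal (shrinks M legal) notLost

    mutual
      enforcerKills : ∀ k s K → freeTotal s ≤ k → Live s K → q ≤ sumOff K (freeIn s) → P K (freeIn s) →
        EWins enforcer s
      enforcerKills k s K le live many PK =
        enfMoves unfinished (kill s K , (kill-fresh s K , inj₁ q≤size) ,
          avoiderToMove k s′ le′ (K , kill-covers s K , kill-live s K live , respects K _ _ PK (kill-freeIn s K)))
        where
        s′ = play enf s (kill s K)
        q≤size : q ≤ size (kill s K)
        q≤size = subst (q ≤_) (sym (kill-size s K)) many
        unfinished : ¬ Finished s
        unfinished fin with claimedElement (kill s K) (≤-trans q≥1 q≤size)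
        ... | i , j , h = fin i j (kill-fresh s K i j h)
        le′ : freeTotal s′ ≤ k
        le′ = ≤-trans (m≤m+n _ (size (kill s K))) (≤-trans (≤-reflexive (claim-freeTotal enf refl s _ (kill-fresh s K))) le)

      avoiderToMove : ∀ k s → freeTotal s ≤ k → Invariant s → EWins avoider s
      avoiderToMove k s le (K , covers , live , PK) with finished? s
      ... | yes fin = over fin (ownedBox s i (fin i) (live i Ki))
        where
        i  = proj₁ (nonempty K _ PK)
        Ki = proj₂ (nonempty K _ PK)
      avoiderToMove zero    s le _ | no unfinished = ⊥-elim (unfinished (empty⇒finished s (n≤0⇒n≡0 le)))
      avoiderToMove (suc k) s le (K , covers , live , PK) | no unfinished = afterAvoider k s le unfinished continue
        where
        continue : ∀ M → Legal p s M → freeTotal (play avd s M) ≤ k → ¬ AvoiderLost (play avd s M) →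
          EWins enforcer (play avd s M)
        continue M legal le′ notLost with
          reply K _ _ PK (avoider-effect s M p≥1 unfinished K covers legal)
                (λ i Ki → liveBox-free s′ notLost i (live′ i Ki))
          where
          s′    = play avd s M
          live′ = avoider-live s M K live
        ... | K′ , K′⊆K , many , PK′ = enforcerKills k _ K′ le′ (λ i K′i → avoider-live s M K live i (K′⊆K i K′i)) many PK′

    planWins : (∀ i → 1 ≤ b i) → Fin n → BoxGame.EnforcerWinsBoth b p q
    planWins b≥1 i₀ = enforcerFirst , avoiderFirst
      where
      start = freeTotal initial
      openFrom : ∀ s → freeTotal s ≤ start → (∀ i j → ¬ (s i j ≡ enf)) → (∀ i → 1 ≤ freeIn s i) → EWins enforcer s
      openFrom s le noEnf pos with opening (freeIn s) (freeIn≤b s) pos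
      ... | K , _ , many , PK = enforcerKills start s K le (λ i _ → noEnf i) many PK
      enforcerFirst : EWins enforcer initial
      enforcerFirst = openFrom initial ≤-refl (λ i j ()) (λ i → subst (1 ≤_) (sym (ΣF-ones (b i))) (b≥1 i))
      noEnf : ∀ M i j → ¬ (play avd initial M i j ≡ enf)
      noEnf M i j h with M i j
      noEnf M i j () | true
      noEnf M i j () | false
      avoiderFirst : EWins avoider initial
      avoiderFirst = afterAvoider start initial (n≤1+n start) (λ fin → fin i₀ (fromℕ< (b≥1 i₀)) refl)
        λ M legal le′ notLost → openFrom _ le′ (noEnf M) (λ i → liveBox-free _ notLost i (noEnf M i))

-- The first N boxes; sumFirst N b is exactly sumOn (firstN N) b.
firstN : ∀ {n} → ℕ → Mask n
firstN N i = toℕ i <ᵇ N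

card-firstN : ∀ n N → N ≤ n → card {n} (firstN N) ≡ N
card-firstN n       zero    _         = ΣF-zero n (λ i → refl)
card-firstN (suc n) (suc N) (s≤s N≤n) = cong suc (card-firstN n N N≤n)

-- With x = q+1 and a large E, a box with v free elements weighs x^(E-v); the potential of K is
-- Φ K f = Σ_{i∈K} x^(E - f i).  Avoider's move of one element strictly increases Φ; Enforcer
-- removes the q boxes with the most free elements.  The invariant |K| ≡ 1 (mod q), Φ ≥ x^(E-1)
-- survives, because all the weights involved are multiples of a common power w of x with
-- quotients ≡ 1 (mod q).  At the start, convexity of v ↦ x^(E-v) (Jensen) gives Φ ≥ x^E.

geom : ℕ → ℕ → ℕ
geom q zero    = 0
geom q (suc j) = 1 + suc q * geom q j

pow≡1+q*geom : ∀ q j → suc q ^ j ≡ 1 + q * geom q j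
pow≡1+q*geom q zero    = cong suc (sym (*-zeroʳ q))
pow≡1+q*geom q (suc j) rewrite pow≡1+q*geom q j = expand q (geom q j)
  where
  expand : ∀ q g → suc q * (1 + q * g) ≡ 1 + q * (1 + suc q * g)
  expand = solve-∀

j≤geom : ∀ q j → j ≤ geom q j
j≤geom q zero    = z≤n
j≤geom q (suc j) = s≤s (≤-trans (j≤geom q j) (m≤n*m (geom q j) (suc q)))

bernoulli : ∀ q j → 1 + q * j ≤ suc q ^ j
bernoulli q j = ≤-trans (+-monoʳ-≤ 1 (*-monoʳ-≤ q (j≤geom q j))) (≤-reflexive (sym (pow≡1+q*geom q j)))

power-split : ∀ x E g h → h ≤ g → g ≤ E → x ^ (E ∸ h) ≡ x ^ (E ∸ g) * x ^ (g ∸ h)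
power-split x E g h h≤g g≤E = trans (cong (x ^_) (sym exponents)) (^-distribˡ-+-* x (E ∸ g) (g ∸ h))
  where
  exponents : (E ∸ g) + (g ∸ h) ≡ E ∸ h
  exponents = trans (sym (+-∸-assoc (E ∸ g) h≤g)) (cong (_∸ h) (m∸n+n≡m g≤E))

-- numbers ≡ w (mod q·w) that differ by less than q·w are ordered like their quotients
residue-step : ∀ w q A B → w * (1 + q * A) < q * w + w * (1 + q * B) → A ≤ B
residue-step w q A B lt = ≤-pred (*-cancelˡ-< q A (suc B) (+-cancelˡ-< 1 (q * A) (q * suc B)
                            (*-cancelˡ-< w _ _ (subst (w * (1 + q * A) <_) (regroup w q B) lt))))
  where
  regroup : ∀ w q B → q * w + w * (1 + q * B) ≡ w * (1 + q * suc B)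
  regroup = solve-∀

module PotentialOneQ {n : ℕ} (q : ℕ) (q≥1 : 1 ≤ q) (E : ℕ) where

  x : ℕ
  x = suc q

  W : ℕ → ℕ
  W v = x ^ (E ∸ v)

  W-anti : ∀ {u v} → u ≤ v → W v ≤ W u
  W-anti u≤v = ^-monoʳ-≤ x (∸-monoʳ-≤ E u≤v)

  W-strict : ∀ {u v} → u < v → v ≤ E → W v < W u
  W-strict u<v v≤E = ^-monoʳ-< x (s≤s q≥1) (∸-monoʳ-< u<v v≤E)

  Φ : Mask n → (Fin n → ℕ) → ℕ
  Φ K f = sumOn K (λ i → W (f i))

  record Inv (K : Mask n) (f : Fin n → ℕ) : Set where
    field
      t         : ℕ
      card≡     : card K ≡ 1 + q * t
      potential : x ^ (E ∸ 1) ≤ Φ K f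
      bounded   : ∀ i → K i ≡ true → f i ≤ E

  Inv-nonempty : ∀ K f → Inv K f → Σ (Fin n) λ i → K i ≡ true
  Inv-nonempty K f inv = card-pos K (subst (1 ≤_) (sym (Inv.card≡ inv)) (s≤s z≤n))

  respects : ∀ K f g → Inv K f → (∀ i → K i ≡ true → f i ≡ g i) → Inv K g
  respects K f g inv e = record
    { t         = t
    ; card≡     = card≡
    ; potential = subst (x ^ (E ∸ 1) ≤_) (sumOn-cong K (λ i Ki → cong W (e i Ki))) potential
    ; bounded   = λ i Ki → subst (_≤ E) (e i Ki) (bounded i Ki)
    }
    where open Inv inv

  -- if f ≤ g ≤ E on L and |L| = 1 + q t, then every W (f i) = W g · x^(g - f i) with
  -- x^(g - f i) ≡ 1 (mod q), so Φ L f = W g · (1 + q (t + S)) where S = Σ_L geom (g - f i)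
  potential-below : ∀ L f g t → (∀ i → L i ≡ true → f i ≤ g) → g ≤ E → card L ≡ 1 + q * t →
    Φ L f ≡ W g * (1 + q * (t + sumOn L (λ i → geom q (g ∸ f i))))
  potential-below L f g t below g≤E cardL = begin
    Φ L f                                   ≡⟨ sumOn-cong L (λ i Li → power-split x E g (f i) (below i Li) g≤E) ⟩
    sumOn L (λ i → W g * x ^ (g ∸ f i))     ≡⟨ sumOn-* L (W g) _ ⟩
    W g * sumOn L (λ i → x ^ (g ∸ f i))     ≡⟨ cong (W g *_) (sumOn-cong L (λ i _ → pow≡1+q*geom q (g ∸ f i))) ⟩
    W g * sumOn L (λ i → 1 + q * geom q (g ∸ f i)) ≡⟨ cong (W g *_) (sumOn-+ L (λ _ → 1) _) ⟩
    W g * (card L + sumOn L (λ i → q * geom q (g ∸ f i))) ≡⟨ cong₂ (λ c s → W g * (c + s)) cardL (sumOn-* L q _) ⟩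
    W g * (1 + q * t + q * S)               ≡⟨ cong (W g *_) (regroup q t S) ⟩
    W g * (1 + q * (t + S))                 ∎
    where
    open ≡-Reasoning
    S = sumOn L (λ i → geom q (g ∸ f i))
    regroup : ∀ q t S → 1 + q * t + q * S ≡ 1 + q * (t + S)
    regroup = solve-∀

  reduce : ∀ K f t → card K ≡ 1 + q * suc t → x ^ (E ∸ 1) < Φ K f →
    (∀ i → K i ≡ true → 1 ≤ f i) → (∀ i → K i ≡ true → f i ≤ E) → Reply q Inv K f
  reduce K f t cardK above pos bounded = kept , kept⊆K , removed-mass split pos , invariant
    where
    split = topSplit q q≥1 K f (subst (q ≤_) (sym cardK) (≤-trans (m≤m*n q (suc t)) (n≤1+n _)))
    open TopSplit split
    g = threshold
    j = proj₁ attained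
    g≥1 : 1 ≤ g
    g≥1 = subst (1 ≤_) (proj₂ (proj₂ attained)) (pos j (proj₁ (proj₂ attained)))
    g≤E : g ≤ E
    g≤E = subst (_≤ E) (proj₂ (proj₂ attained)) (bounded j (proj₁ (proj₂ attained)))
    cardKept : card kept ≡ 1 + q * t
    cardKept = +-cancelˡ-≡ q _ _ (trans (sym card-split) (trans cardK (regroup q t)))
      where
      regroup : ∀ q t → 1 + q * suc t ≡ q + (1 + q * t)
      regroup = solve-∀
    S = sumOn kept (λ i → geom q (g ∸ f i))
    Φkept : Φ kept f ≡ W g * (1 + q * (t + S))
    Φkept = potential-below kept f g t kept-below g≤E cardKept
    G = geom q (g ∸ 1)
    threshold-weight : x ^ (E ∸ 1) ≡ W g * (1 + q * G)
    threshold-weight = trans (power-split x E g 1 g≥1 g≤E) (cong (W g *_) (pow≡1+q*geom q (g ∸ 1)))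
    -- the q removed boxes weigh at most W g each
    Φ≤ : Φ K f ≤ q * W g + Φ kept f
    Φ≤ = removed-upper (λ i → W (f i)) (W g) (λ _ _ g≤fi → W-anti g≤fi)
    G≤ : G ≤ t + S
    G≤ = residue-step (W g) q G (t + S) (begin-strict
      W g * (1 + q * G)               ≡⟨ threshold-weight ⟨
      x ^ (E ∸ 1)                     <⟨ above ⟩
      Φ K f                           ≤⟨ Φ≤ ⟩
      q * W g + Φ kept f              ≡⟨ cong (q * W g +_) Φkept ⟩
      q * W g + W g * (1 + q * (t + S)) ∎)
      where open ≤-Reasoning
    invariant : Inv kept f
    invariant = record
      { t         = t
      ; card≡     = cardKept
      ; potential = begin
          x ^ (E ∸ 1)               ≡⟨ threshold-weight ⟩
          W g * (1 + q * G)         ≤⟨ *-monoʳ-≤ (W g) (+-monoʳ-≤ 1 (*-monoʳ-≤ q G≤)) ⟩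
          W g * (1 + q * (t + S))   ≡⟨ Φkept ⟨
          Φ kept f                  ∎
      ; bounded   = λ i ki → bounded i (kept⊆K i ki)
      }
      where open ≤-Reasoning

  singleton-bound : ∀ K f i → card K ≡ 1 → K i ≡ true → x ^ (E ∸ 1) ≤ Φ K f → f i ≤ E → f i ≤ 1
  singleton-bound K f i single Ki above fi≤E with f i ≤? 1
  ... | yes fi≤1 = fi≤1
  ... | no  fi≰1 = ⊥-elim (<⇒≱ (W-strict (≰⇒> fi≰1) fi≤E) (subst (x ^ (E ∸ 1) ≤_) (sumOn-single K _ i single Ki) above))

  reply : ∀ K f f' → Inv K f → AvoiderEffect 1 K f f' → (∀ i → K i ≡ true → 1 ≤ f' i) → Reply q Inv K f'
  reply K f f' inv effect pos = byCard t card≡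
    where
    open Inv inv
    open AvoiderEffect effect
    -- some box lost a free element, and it lies in K
    shrunk = ΣF-strict⁻¹ n decreasing (subst (ΣF n f' <_) conservation (m<m+n (ΣF n f') progress))
    i = proj₁ shrunk
    f'i<fi : f' i < f i
    f'i<fi = proj₂ shrunk
    Ki : K i ≡ true
    Ki with K i in e
    ... | true  = refl
    ... | false = ⊥-elim (<⇒≱ f'i<fi (subst (_≤ f' i) (sym (outside-empty i e)) z≤n))
    bounded' : ∀ i → K i ≡ true → f' i ≤ E
    bounded' i Ki = ≤-trans (decreasing i) (bounded i Ki)
    increases : Φ K f < Φ K f'
    increases = sumOn-strict K (λ i _ → W-anti (decreasing i)) i Ki (W-strict f'i<fi (bounded i Ki))
    byCard : ∀ t → card K ≡ 1 + q * t → Reply q Inv K f'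
    byCard zero    single = ⊥-elim (<⇒≱ (≤-<-trans (pos i Ki) f'i<fi)
                              (singleton-bound K f i (trans single (cong suc (*-zeroʳ q))) Ki potential (bounded i Ki)))
    byCard (suc t) cardK  = reduce K f' t cardK (≤-<-trans potential increases) pos bounded'

  -- the chord of the convex map W through k and k+1 lies below W at every integer v ≤ E
  chord-bound : ∀ k v → suc k ≤ E → v ≤ E → W (suc k) * (x + q * k) ≤ W v + q * W (suc k) * v
  chord-bound k v k<E v≤E with v ≤? k
  ... | yes v≤k = begin
    u * (x + q * k)                 ≡⟨ cong (λ z → u * (x + q * z)) (sym (m∸n+n≡m v≤k)) ⟩
    u * (x + q * (j + v))           ≡⟨ regroup u q j v ⟩
    u * (1 + q * suc j) + q * u * v ≤⟨ +-monoˡ-≤ (q * u * v) (*-monoʳ-≤ u (bernoulli q (suc j))) ⟩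
    u * x ^ suc j + q * u * v       ≡⟨ cong (λ z → u * x ^ z + q * u * v) (sym (+-∸-assoc 1 v≤k)) ⟩
    u * x ^ (suc k ∸ v) + q * u * v ≡⟨ cong (_+ q * u * v) (sym (power-split x E (suc k) v (m≤n⇒m≤1+n v≤k) k<E)) ⟩
    W v + q * u * v                 ∎
    where
    open ≤-Reasoning
    u = W (suc k)
    j = k ∸ v
    regroup : ∀ u q j v → u * (suc q + q * (j + v)) ≡ u * (1 + q * suc j) + q * u * v
    regroup = solve-∀
  ... | no v≰k with suc k ≟ v
  ...   | yes refl = ≤-reflexive (regroup (W (suc k)) q k)
    where
    regroup : ∀ u q k → u * (suc q + q * k) ≡ u + q * u * suc k
    regroup = solve-∀
  ...   | no  k+1≢v = begin
    u * (x + q * k)         ≡⟨ regroup₁ u q k ⟩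
    u + q * u * suc k       ≤⟨ +-monoˡ-≤ (q * u * suc k) (m≤n*m u q {{>-nonZero q≥1}}) ⟩
    q * u + q * u * suc k   ≡⟨ regroup₂ u q k ⟩
    q * u * suc (suc k)     ≤⟨ *-monoʳ-≤ (q * u) (≤∧≢⇒< (≰⇒> v≰k) k+1≢v) ⟩
    q * u * v               ≤⟨ m≤n+m (q * u * v) (W v) ⟩
    W v + q * u * v         ∎
    where
    open ≤-Reasoning
    u = W (suc k)
    regroup₁ : ∀ u q k → u * (suc q + q * k) ≡ u + q * u * suc k
    regroup₁ = solve-∀
    regroup₂ : ∀ u q k → q * u + q * u * suc k ≡ q * u * suc (suc k)
    regroup₂ = solve-∀

  jensen : ∀ (K : Mask n) (h : Fin n → ℕ) k → (∀ i → K i ≡ true → h i ≤ E) → suc k ≤ E →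
    sumOn K h ≤ k * card K → card K ≡ x ^ k → x ^ E ≤ Φ K h
  jensen K h k h≤E k<E average cardK = subst (_≤ Φ K h) (sym total) (+-cancelʳ-≤ _ _ _ (begin
    c * u * x + q * u * (k * c)                ≡⟨ regroup c u q k ⟩
    c * (u * (x + q * k))                      ≤⟨ card*≤sumOn K _ _ (λ i Ki → chord-bound k (h i) k<E (h≤E i Ki)) ⟩
    sumOn K (λ i → W (h i) + q * u * h i)      ≡⟨ trans (sumOn-+ K _ _) (cong (Φ K h +_) (sumOn-* K (q * u) h)) ⟩
    Φ K h + q * u * sumOn K h                  ≤⟨ +-monoʳ-≤ (Φ K h) (*-monoʳ-≤ (q * u) average) ⟩
    Φ K h + q * u * (k * c)                    ∎))
    where
    open ≤-Reasoning
    u = W (suc k)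
    c = card K
    regroup : ∀ c u q k → c * u * suc q + q * u * (k * c) ≡ c * (u * (suc q + q * k))
    regroup = solve-∀
    total : x ^ E ≡ c * u * x
    total = begin-equality
      x ^ E                           ≡⟨ cong (x ^_) (sym (m+[n∸m]≡n k<E)) ⟩
      x ^ (suc k + (E ∸ suc k))       ≡⟨ ^-distribˡ-+-* x (suc k) (E ∸ suc k) ⟩
      x * x ^ k * u                   ≡⟨ rotate x (x ^ k) u ⟩
      x ^ k * u * x                   ≡⟨ cong (λ z → z * u * x) (sym cardK) ⟩
      c * u * x                       ∎
      where
      rotate : ∀ x a u → x * a * u ≡ a * u * x
      rotate = solve-∀

  -- Enforcer's opening: among the first x^k boxes (average size ≤ k) Jensen gives Φ ≥ x^E,
  -- and one reduction establishes the invariant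
  opening : ∀ (b : Fin n → ℕ) k → 1 ≤ k → x ^ k ≤ n → (∀ i → b i ≤ E) → suc k ≤ E →
    sumFirst (x ^ k) b ≤ k * x ^ k → ∀ f → (∀ i → f i ≤ b i) → (∀ i → 1 ≤ f i) → Reply q Inv (λ _ → true) f
  opening b (suc k) _ N≤n b≤E k<E average f f≤b pos with reduce T f (x * geom q k) cardT above (λ i _ → pos i) f≤E
    where
    T = firstN (x ^ suc k)
    cardN : card T ≡ x ^ suc k
    cardN = card-firstN n (x ^ suc k) N≤n
    cardT : card T ≡ 1 + q * suc (x * geom q k)
    cardT = trans cardN (pow≡1+q*geom q (suc k))
    f≤E : ∀ i → T i ≡ true → f i ≤ E
    f≤E i _ = ≤-trans (f≤b i) (b≤E i)
    above : x ^ (E ∸ 1) < Φ T f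
    above = <-≤-trans (^-monoʳ-< x (s≤s q≥1) (∸-monoʳ-< {o = 0} (s≤s z≤n) (≤-trans (s≤s z≤n) k<E)))
      (≤-trans (jensen T b (suc k) (λ i _ → b≤E i) k<E (subst (sumOn T b ≤_) (cong (suc k *_) (sym cardN)) average) cardN)
               (sumOn-mono T (λ i _ → W-anti (f≤b i))))
  ... | K , _ , many , inv = K , (λ _ _ → refl) , many , inv

-- Enforcer kills, each round, the live box with the most free elements.  With weights
-- w m = c/m (so hsum w is c times a harmonic sum) the invariant for m = |K| live boxes is
--   c · Σ_K f + m p H(M) ≤ m c k + m p H(m),  i.e.  avg_K f ≤ k - p (H(M) - H(m)) / c.
-- Avoider's move lowers Σ_K f by ≥ p; removing the maximal box does not raise the average
-- and lowers H(m) by w m = c/m, which the p/m drop of the average pays for.  When m = 1 the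
-- invariant and c k ≤ p H(M) leave Avoider no legal move that keeps the last box alive.

hsum : (ℕ → ℕ) → ℕ → ℕ
hsum w zero    = 0
hsum w (suc j) = hsum w j + w (suc j)

-- the arithmetic of one round with m+1 live boxes before Enforcer's kill:
-- F, F', F₃ are the free totals before Avoider's move, after it, and after the kill
harmonic-step : ∀ m c k p F F' F₃ hM hm wm →
  suc m * F₃ ≤ m * F' → F' + p ≤ F → suc m * wm ≡ c →
  c * F + suc m * p * hM ≤ suc m * c * k + suc m * p * (hm + wm) →
  c * F₃ + m * p * hM ≤ m * c * k + m * p * hm
harmonic-step m c k p F F' F₃ hM hm wm average drop weight before =
  *-cancelˡ-≤ (suc m) (+-cancelʳ-≤ (m * c * p) _ _ (≤-trans scaled (≤-trans (*-monoʳ-≤ m before) (≤-reflexive expand))))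
  where
  open ≤-Reasoning
  scaled : suc m * (c * F₃ + m * p * hM) + m * c * p ≤ m * (c * F + suc m * p * hM)
  scaled = begin
    suc m * (c * F₃ + m * p * hM) + m * c * p          ≡⟨ regroup₁ m c F₃ p hM ⟩
    c * (suc m * F₃) + suc m * m * p * hM + m * c * p   ≤⟨ +-monoˡ-≤ _ (+-monoˡ-≤ _ (*-monoʳ-≤ c average)) ⟩
    c * (m * F') + suc m * m * p * hM + m * c * p       ≡⟨ regroup₂ c m F' p hM ⟩
    m * (c * (F' + p)) + m * (suc m * p * hM)           ≤⟨ +-monoˡ-≤ _ (*-monoʳ-≤ m (*-monoʳ-≤ c drop)) ⟩
    m * (c * F) + m * (suc m * p * hM)                  ≡⟨ *-distribˡ-+ m (c * F) _ ⟨
    m * (c * F + suc m * p * hM)                        ∎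
    where
    regroup₁ : ∀ m c F₃ p h → suc m * (c * F₃ + m * p * h) + m * c * p ≡ c * (suc m * F₃) + suc m * m * p * h + m * c * p
    regroup₁ = solve-∀
    regroup₂ : ∀ c m F' p h → c * (m * F') + suc m * m * p * h + m * c * p ≡ m * (c * (F' + p)) + m * (suc m * p * h)
    regroup₂ = solve-∀
  expand : m * (suc m * c * k + suc m * p * (hm + wm)) ≡ suc m * (m * c * k + m * p * hm) + m * c * p
  expand = begin-equality
    m * (suc m * c * k + suc m * p * (hm + wm))            ≡⟨ regroup m c k p hm wm ⟩
    suc m * (m * c * k + m * p * hm) + m * p * (suc m * wm) ≡⟨ cong (λ z → suc m * (m * c * k + m * p * hm) + m * p * z) weight ⟩
    suc m * (m * c * k + m * p * hm) + m * p * c           ≡⟨ cong (suc m * (m * c * k + m * p * hm) +_) (*-assoc-swap m p c) ⟩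
    suc m * (m * c * k + m * p * hm) + m * c * p           ∎
    where
    regroup : ∀ m c k p h wm → m * (suc m * c * k + suc m * p * (h + wm)) ≡ suc m * (m * c * k + m * p * h) + m * p * (suc m * wm)
    regroup = solve-∀
    *-assoc-swap : ∀ m p c → m * p * c ≡ m * c * p
    *-assoc-swap = solve-∀

single-box-bound : ∀ c k p F hM h₁ → .{{NonZero c}} → h₁ ≡ c →
  c * F + 1 * p * hM ≤ 1 * c * k + 1 * p * h₁ → c * k ≤ p * hM → F ≤ p
single-box-bound c k p F hM h₁ h₁≡c invariant enough = *-cancelˡ-≤ c (+-cancelʳ-≤ (p * hM) _ _ (begin
  c * F + p * hM        ≡⟨ cong (λ z → c * F + z * hM) (*-identityˡ p) ⟨
  c * F + 1 * p * hM    ≤⟨ invariant ⟩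
  1 * c * k + 1 * p * h₁ ≡⟨ cong₂ _+_ (cong (_* k) (*-identityˡ c)) (trans (cong (_* h₁) (*-identityˡ p)) (cong (p *_) h₁≡c)) ⟩
  c * k + p * c         ≤⟨ +-monoˡ-≤ (p * c) enough ⟩
  p * hM + p * c        ≡⟨ trans (+-comm (p * hM) (p * c)) (cong (_+ p * hM) (*-comm p c)) ⟩
  c * p + p * hM        ∎))
  where open ≤-Reasoning

module PotentialP1 {n : ℕ} (p k c : ℕ) {{c≢0 : NonZero c}} (w : ℕ → ℕ) (M : ℕ)
    (harmonic : ∀ m → 1 ≤ m → m ≤ M → m * w m ≡ c) (long : c * k ≤ p * hsum w M) where

  H : ℕ → ℕ
  H = hsum w

  AverageBound : ℕ → ℕ → Set
  AverageBound m F = c * F + m * p * H M ≤ m * c * k + m * p * H m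

  record Inv (K : Mask n) (f : Fin n → ℕ) : Set where
    field
      nonempty : 1 ≤ card K
      small    : card K ≤ M
      average  : AverageBound (card K) (sumOn K f)

  Inv-nonempty : ∀ K f → Inv K f → Σ (Fin n) λ i → K i ≡ true
  Inv-nonempty K f inv = card-pos K (Inv.nonempty inv)

  respects : ∀ K f g → Inv K f → (∀ i → K i ≡ true → f i ≡ g i) → Inv K g
  respects K f g inv e = record
    { nonempty = nonempty ; small = small ; average = subst (AverageBound (card K)) (sumOn-cong K e) average }
    where open Inv inv

  lastBox : ∀ K f f' → Inv K f → card K ≡ 1 → sumOn K f' + p ≤ sumOn K f → (∀ i → K i ≡ true → 1 ≤ f' i) → ⊥
  lastBox K f f' inv single drop pos = <⇒≱ (≤-trans (+-monoˡ-≤ p F'≥1) drop) F≤p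
    where
    open Inv inv
    F≤p : sumOn K f ≤ p
    F≤p = single-box-bound c k p (sumOn K f) (H M) (H 1)
            (trans (sym (*-identityˡ (w 1))) (harmonic 1 ≤-refl (subst (_≤ M) single small)))
            (subst (λ m → AverageBound m (sumOn K f)) single average) long
    F'≥1 : 1 ≤ sumOn K f'
    F'≥1 = subst (_≤ sumOn K f') (cong (_* 1) single) (card*≤sumOn K f' 1 pos)

  killFullest : ∀ K f f' m → Inv K f → card K ≡ suc (suc m) → sumOn K f' + p ≤ sumOn K f →
    (∀ i → K i ≡ true → 1 ≤ f' i) → Reply 1 Inv K f'
  killFullest K f f' m inv cardK drop pos = kept , kept⊆K , removed-mass split pos , keptInv
    where
    open Inv inv
    split = topSplit 1 ≤-refl K f' nonempty
    open TopSplit split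
    cardKept : card kept ≡ suc m
    cardKept = suc-injective (trans (sym card-split) cardK)
    keptInv : Inv kept f'
    keptInv = record
      { nonempty = subst (1 ≤_) (sym cardKept) (s≤s z≤n)
      ; small    = ≤-trans (≤-reflexive cardKept) (≤-trans (n≤1+n (suc m)) (subst (_≤ M) cardK small))
      ; average  = subst (λ m′ → AverageBound m′ (sumOn kept f')) (sym cardKept)
          (harmonic-step (suc m) c k p (sumOn K f) (sumOn K f') (sumOn kept f') (H M) (H (suc m)) (w (suc (suc m)))
            (subst₂ (λ u v → u * sumOn kept f' ≤ v * sumOn K f') cardK cardKept (kept-average split))
            drop
            (harmonic (suc (suc m)) (s≤s z≤n) (subst (_≤ M) cardK small))
            (subst (λ m′ → AverageBound m′ (sumOn K f)) cardK average))
      }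

  reply : ∀ K f f' → Inv K f → AvoiderEffect p K f f' → (∀ i → K i ≡ true → 1 ≤ f' i) → Reply 1 Inv K f'
  reply K f f' inv effect pos = byEnough enough
    where
    open Inv inv
    open AvoiderEffect effect
    someLive = card-pos K nonempty
    byEnough : p ≤ claimed ⊎ (∀ i → f' i ≡ 0) → Reply 1 Inv K f'
    byEnough (inj₂ allTaken) = ⊥-elim (<⇒≱ (pos (proj₁ someLive) (proj₂ someLive)) (≤-reflexive (allTaken (proj₁ someLive))))
    byEnough (inj₁ p≤claimed) = byCard (card K) refl
      where
      vanishes' : ∀ i → K i ≡ false → f' i ≡ 0
      vanishes' i Ki = n≤0⇒n≡0 (subst (f' i ≤_) (outside-empty i Ki) (decreasing i))
      drop : sumOn K f' + p ≤ sumOn K f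
      drop = begin
        sumOn K f' + p       ≤⟨ +-monoʳ-≤ (sumOn K f') p≤claimed ⟩
        sumOn K f' + claimed ≡⟨ cong (_+ claimed) (sumOn-all K f' vanishes') ⟩
        ΣF n f' + claimed    ≡⟨ conservation ⟩
        ΣF n f               ≡⟨ sumOn-all K f outside-empty ⟨
        sumOn K f            ∎
        where open ≤-Reasoning
      byCard : ∀ m → card K ≡ m → Reply 1 Inv K f'
      byCard zero          e = ⊥-elim (<⇒≱ nonempty (≤-reflexive e))
      byCard (suc zero)    e = ⊥-elim (lastBox K f f' inv e drop pos)
      byCard (suc (suc m)) e = killFullest K f f' m inv e drop pos

  opening : ∀ (b : Fin n → ℕ) → 1 ≤ M → suc M ≤ n → sumFirst (suc M) b ≤ k * suc M →
    ∀ f → (∀ i → f i ≤ b i) → (∀ i → 1 ≤ f i) → Reply 1 Inv (λ _ → true) f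
  opening b M≥1 N≤n average f f≤b pos = kept , (λ _ _ → refl) , removed-mass split (λ i _ → pos i) , keptInv
    where
    T = firstN (suc M)
    cardT : card T ≡ suc M
    cardT = card-firstN n (suc M) N≤n
    split = topSplit 1 ≤-refl T f (subst (1 ≤_) (sym cardT) (s≤s z≤n))
    open TopSplit split
    cardKept : card kept ≡ M
    cardKept = suc-injective (trans (sym card-split) cardT)
    F₃ = sumOn kept f
    F₃≤ : F₃ ≤ M * k
    F₃≤ = *-cancelˡ-≤ (suc M) (begin
      suc M * F₃         ≡⟨ cong (_* F₃) cardT ⟨
      card T * F₃        ≤⟨ kept-average split ⟩
      card kept * sumOn T f ≤⟨ *-monoʳ-≤ (card kept) (≤-trans (sumOn-mono T (λ i _ → f≤b i)) average) ⟩
      card kept * (k * suc M) ≡⟨ cong (_* (k * suc M)) cardKept ⟩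
      M * (k * suc M)    ≡⟨ regroup M k (suc M) ⟩
      suc M * (M * k)    ∎)
      where
      open ≤-Reasoning
      regroup : ∀ M k N → M * (k * N) ≡ N * (M * k)
      regroup = solve-∀
    keptInv : Inv kept f
    keptInv = record
      { nonempty = subst (1 ≤_) (sym cardKept) M≥1
      ; small    = ≤-reflexive cardKept
      ; average  = subst (λ m → AverageBound m F₃) (sym cardKept)
          (+-monoˡ-≤ (M * p * H M) (≤-trans (*-monoʳ-≤ c F₃≤) (≤-reflexive (regroup c M k))))
      }
      where
      regroup : ∀ c M k → c * (M * k) ≡ M * c * k
      regroup = solve-∀

-- With w m = c/m on 1..M', the condition p · H(M') ≤ c k says p Σ_{m ≤ M'} 1/m ≤ k, and
-- (M'+1)^p = Π_{m ≤ M'} (1 + 1/m)^p ≤ e^(p Σ 1/m) ≤ e^k.  Over ℕ this is carried out with the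
-- truncated exponential series, scaled to integers: expPoly Y c t = c^t t! Σ_{j ≤ t} (Y/c)^j / j!.

^-distribʳ-* : ∀ a b o → (a * b) ^ o ≡ a ^ o * b ^ o
^-distribʳ-* a b zero    = refl
^-distribʳ-* a b (suc o) rewrite ^-distribʳ-* a b o = regroup a b (a ^ o) (b ^ o)
  where
  regroup : ∀ a b x y → a * b * (x * y) ≡ a * x * (b * y)
  regroup = solve-∀

expPoly : ℕ → ℕ → ℕ → ℕ
expPoly Y c zero    = 1
expPoly Y c (suc t) = suc t * c * expPoly Y c t + Y ^ suc t

expPoly-mono : ∀ {Y Y'} c t → Y ≤ Y' → expPoly Y c t ≤ expPoly Y' c t
expPoly-mono c zero    Y≤Y' = ≤-refl
expPoly-mono c (suc t) Y≤Y' = +-mono-≤ (*-monoʳ-≤ (suc t * c) (expPoly-mono c t Y≤Y')) (^-monoˡ-≤ (suc t) Y≤Y')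

expPoly-expS : ∀ c k t → expPoly (c * k) c t ≡ c ^ t * expS k t
expPoly-expS c k zero    = refl
expPoly-expS c k (suc t) rewrite expPoly-expS c k t | ^-distribʳ-* c k (suc t) =
  regroup (suc t) c (c ^ t) (expS k t) (k ^ suc t)
  where
  regroup : ∀ s c x e y → s * c * (x * e) + c * x * y ≡ c * x * (s * e + y)
  regroup = solve-∀

binomial-bound : ∀ Y A t → Y ^ suc t + suc t * A * Y ^ t ≤ (Y + A) ^ suc t
binomial-bound Y A zero    = ≤-reflexive (regroup Y A)
  where
  regroup : ∀ Y A → Y * 1 + 1 * A * 1 ≡ (Y + A) * 1
  regroup = solve-∀
binomial-bound Y A (suc t) = begin
  Y ^ suc (suc t) + suc (suc t) * A * Y ^ suc t ≤⟨ drop-square Y A t (Y ^ t) ⟩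
  (Y + A) * (Y ^ suc t + suc t * A * Y ^ t)     ≤⟨ *-monoʳ-≤ (Y + A) (binomial-bound Y A t) ⟩
  (Y + A) ^ suc (suc t)                         ∎
  where
  open ≤-Reasoning
  drop-square : ∀ Y A t y → Y * (Y * y) + suc (suc t) * A * (Y * y) ≤ (Y + A) * (Y * y + suc t * A * y)
  drop-square Y A t y = ≤-trans (m≤m+n _ (suc t * A * A * y)) (≤-reflexive (expand Y A t y))
    where
    expand : ∀ Y A t y → Y * (Y * y) + suc (suc t) * A * (Y * y) + suc t * A * A * y ≡ (Y + A) * (Y * y + suc t * A * y)
    expand = solve-∀

-- a first-order Taylor bound: E_{t+1}(y + a) ≥ E_{t+1}(y) + a E_t(y), scaled
expPoly-shift : ∀ Y A c t → expPoly Y c (suc t) + suc t * A * expPoly Y c t ≤ expPoly (Y + A) c (suc t)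
expPoly-shift Y A c zero    = ≤-reflexive (regroup Y A c)
  where
  regroup : ∀ Y A c → 1 * c * 1 + Y * 1 + 1 * A * 1 ≡ 1 * c * 1 + (Y + A) * 1
  regroup = solve-∀
expPoly-shift Y A c (suc t) = begin
  expPoly Y c (suc (suc t)) + suc (suc t) * A * expPoly Y c (suc t)
    ≡⟨ regroup (suc t) c (expPoly Y c t) (Y ^ suc t) (Y ^ suc (suc t)) A ⟩
  suc (suc t) * c * (expPoly Y c (suc t) + suc t * A * expPoly Y c t) + (Y ^ suc (suc t) + suc (suc t) * A * Y ^ suc t)
    ≤⟨ +-mono-≤ (*-monoʳ-≤ (suc (suc t) * c) (expPoly-shift Y A c t)) (binomial-bound Y A (suc t)) ⟩
  suc (suc t) * c * expPoly (Y + A) c (suc t) + (Y + A) ^ suc (suc t) ∎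
  where
  open ≤-Reasoning
  regroup : ∀ s c g y₁ y₂ A → suc s * c * (s * c * g + y₁) + y₂ + suc s * A * (s * c * g + y₁)
                              ≡ suc s * c * ((s * c * g + y₁) + s * A * g) + (y₂ + suc s * A * y₁)
  regroup = solve-∀

-- one factor (1 + 1/m): increasing Y by A = c/m and t by one gains a factor (m+1)/m
expPoly-step : ∀ Y A c t m → m * A ≡ c → suc t * c * suc m * expPoly Y c t ≤ m * expPoly (Y + A) c (suc t)
expPoly-step Y A c t m mA≡c = begin
  suc t * c * suc m * G                          ≡⟨ regroup₁ (suc t) c m G ⟩
  suc t * c * m * G + suc t * c * G              ≤⟨ m≤m+n _ (m * Y ^ suc t) ⟩
  suc t * c * m * G + suc t * c * G + m * Y ^ suc t
    ≡⟨ cong (λ z → suc t * c * m * G + suc t * z * G + m * Y ^ suc t) (sym mA≡c) ⟩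
  suc t * c * m * G + suc t * (m * A) * G + m * Y ^ suc t ≡⟨ regroup₂ (suc t) c m G A (Y ^ suc t) ⟩
  m * (expPoly Y c (suc t) + suc t * A * G)      ≤⟨ *-monoʳ-≤ m (expPoly-shift Y A c t) ⟩
  m * expPoly (Y + A) c (suc t)                  ∎
  where
  open ≤-Reasoning
  G = expPoly Y c t
  regroup₁ : ∀ s c m G → s * c * suc m * G ≡ s * c * m * G + s * c * G
  regroup₁ = solve-∀
  regroup₂ : ∀ s c m G A y → s * c * m * G + s * (m * A) * G + m * y ≡ m * (s * c * G + y + s * A * G)
  regroup₂ = solve-∀

module ExpChain (c : ℕ) where

  -- u / v ≤ E_t(Y/c), scaled to integers
  Bound : ℕ → ℕ → ℕ → ℕ → Set
  Bound u v Y t = u * c ^ t * t ! ≤ v * expPoly Y c t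

  Bound-cong : ∀ {u u' v v' Y Y' t t'} → u ≡ u' → v ≡ v' → Y ≡ Y' → t ≡ t' → Bound u v Y t → Bound u' v' Y' t'
  Bound-cong refl refl refl refl bound = bound

  Bound-step : ∀ {u v Y t} m A → m * A ≡ c → Bound u v Y t → Bound (u * suc m) (v * m) (Y + A) (suc t)
  Bound-step {u} {v} {Y} {t} m A mA≡c bound = begin
    u * suc m * c ^ suc t * suc t !           ≡⟨ regroup₁ u (suc m) c (c ^ t) (suc t) (t !) ⟩
    suc t * c * suc m * (u * c ^ t * t !)     ≤⟨ *-monoʳ-≤ (suc t * c * suc m) bound ⟩
    suc t * c * suc m * (v * expPoly Y c t)   ≡⟨ regroup₂ (suc t) c (suc m) v (expPoly Y c t) ⟩
    v * (suc t * c * suc m * expPoly Y c t)   ≤⟨ *-monoʳ-≤ v (expPoly-step Y A c t m mA≡c) ⟩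
    v * (m * expPoly (Y + A) c (suc t))       ≡⟨ *-assoc v m _ ⟨
    v * m * expPoly (Y + A) c (suc t)         ∎
    where
    open ≤-Reasoning
    regroup₁ : ∀ u sm c ct st tf → u * sm * (c * ct) * (st * tf) ≡ st * c * sm * (u * ct * tf)
    regroup₁ = solve-∀
    regroup₂ : ∀ st c sm v G → st * c * sm * (v * G) ≡ v * (st * c * sm * G)
    regroup₂ = solve-∀

  -- the factor (1 + 1/m)^i
  Bound-iterate : ∀ {u v Y t} m A → m * A ≡ c → ∀ i → Bound u v Y t →
    Bound (u * suc m ^ i) (v * m ^ i) (Y + i * A) (t + i)
  Bound-iterate {u} {v} {Y} {t} m A mA≡c zero bound =
    Bound-cong (sym (*-identityʳ u)) (sym (*-identityʳ v)) (sym (+-identityʳ Y)) (sym (+-identityʳ t)) bound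
  Bound-iterate {u} {v} {Y} {t} m A mA≡c (suc i) bound =
    Bound-cong (regroup₁ u (suc m ^ i) (suc m)) (regroup₁ v (m ^ i) m) (regroup₂ Y i A) (sym (+-suc t i))
      (Bound-step {u * suc m ^ i} {v * m ^ i} {Y + i * A} {t + i} m A mA≡c (Bound-iterate {u} {v} {Y} {t} m A mA≡c i bound))
    where
    regroup₁ : ∀ u x s → u * x * s ≡ u * (s * x)
    regroup₁ = solve-∀
    regroup₂ : ∀ Y i A → Y + i * A + A ≡ Y + suc i * A
    regroup₂ = solve-∀

  -- the product Π_{m ≤ j} (1 + 1/m)^p = (j+1)^p
  Bound-harmonic : (w : ℕ → ℕ) (p L : ℕ) → (∀ m → 1 ≤ m → m ≤ L → m * w m ≡ c) →
    ∀ j → j ≤ L → Bound ((suc j !) ^ p) ((j !) ^ p) (p * hsum w j) (p * j)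
  Bound-harmonic w p L harmonic zero _ =
    Bound-cong (sym (^-zeroˡ p)) (sym (^-zeroˡ p)) (sym (*-zeroʳ p)) (sym (*-zeroʳ p)) ≤-refl
  Bound-harmonic w p L harmonic (suc j) j<L =
    Bound-cong factorial₁ factorial₂ (sym (*-distribˡ-+ p (hsum w j) (w (suc j)))) (trans (+-comm (p * j) p) (sym (*-suc p j)))
      (Bound-iterate {(suc j !) ^ p} {(j !) ^ p} {p * hsum w j} {p * j} (suc j) (w (suc j)) (harmonic (suc j) (s≤s z≤n) j<L) p
        (Bound-harmonic w p L harmonic j (≤-trans (n≤1+n j) j<L)))
    where
    factorial₁ : (suc j !) ^ p * suc (suc j) ^ p ≡ (suc (suc j) !) ^ p
    factorial₁ = trans (*-comm ((suc j !) ^ p) (suc (suc j) ^ p)) (sym (^-distribʳ-* (suc (suc j)) (suc j !) p))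
    factorial₂ : (j !) ^ p * suc j ^ p ≡ (suc j !) ^ p
    factorial₂ = trans (*-comm ((j !) ^ p) (suc j ^ p)) (sym (^-distribʳ-* (suc j) (j !) p))

harmonic⇒LeExp : ∀ p k c (w : ℕ → ℕ) M' → .{{NonZero c}} → (∀ m → 1 ≤ m → m ≤ M' → m * w m ≡ c) →
  p * hsum w M' ≤ c * k → LeExp (suc M' ^ p) k
harmonic⇒LeExp p k c w M' harmonic small d d≥1 = t , (begin-strict
  suc M' ^ p * d * t !      ≡⟨ regroup (suc M' ^ p) d (t !) ⟩
  d * (suc M' ^ p * t !)    ≤⟨ *-monoʳ-≤ d partialSum ⟩
  d * expS k t              <⟨ m<m+n (d * expS k t) (1≤n! t) ⟩
  d * expS k t + t !        ∎)
  where
  open ExpChain c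
  open ≤-Reasoning
  t = p * M'
  v = (M' !) ^ p
  instance
    v≢0 : NonZero v
    v≢0 = m^n≢0 (M' !) p {{>-nonZero (1≤n! M')}}
    vct≢0 : NonZero (v * c ^ t)
    vct≢0 = m*n≢0 v (c ^ t) {{v≢0}} {{m^n≢0 c t}}
  regroup : ∀ a d f → a * d * f ≡ d * (a * f)
  regroup = solve-∀
  partialSum : suc M' ^ p * t ! ≤ expS k t
  partialSum = *-cancelʳ-≤ _ _ (v * c ^ t) (begin
    suc M' ^ p * t ! * (v * c ^ t)    ≡⟨ regroup₁ (suc M' ^ p) (t !) v (c ^ t) ⟩
    (suc M' ^ p * v) * c ^ t * t !    ≡⟨ cong (λ z → z * c ^ t * t !) (sym (^-distribʳ-* (suc M') (M' !) p)) ⟩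
    (suc M' !) ^ p * c ^ t * t !      ≤⟨ Bound-harmonic w p M' harmonic M' ≤-refl ⟩
    v * expPoly (p * hsum w M') c t   ≤⟨ *-monoʳ-≤ v (expPoly-mono c t small) ⟩
    v * expPoly (c * k) c t           ≡⟨ cong (v *_) (expPoly-expS c k t) ⟩
    v * (c ^ t * expS k t)            ≡⟨ regroup₂ v (c ^ t) (expS k t) ⟩
    expS k t * (v * c ^ t)            ∎)
    where
    regroup₁ : ∀ a b v x → a * b * (v * x) ≡ a * v * x * b
    regroup₁ = solve-∀
    regroup₂ : ∀ v x e → v * (x * e) ≡ e * (v * x)
    regroup₂ = solve-∀

crossing : (Q : ℕ → Set) → (∀ m → Dec (Q m)) → ∀ d j → ¬ Q j → Q (j + d) →
  Σ ℕ λ M → ¬ Q M × Q (suc M) × suc M ≤ j + d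
crossing Q Q? zero    j ¬Qj Qj+d = ⊥-elim (¬Qj (subst Q (+-identityʳ j) Qj+d))
crossing Q Q? (suc d) j ¬Qj Qj+d with Q? (suc j)
... | yes Qj+1 = j , ¬Qj , Qj+1 , subst (suc j ≤_) (sym (+-suc j d)) (s≤s (m≤m+n j d))
... | no ¬Qj+1 with crossing Q Q? d (suc j) ¬Qj+1 (subst Q (+-suc j d) Qj+d)
...   | M , ¬QM , QM+1 , M<j+d = M , ¬QM , QM+1 , subst (suc M ≤_) (sym (+-suc j d)) M<j+d

-- Choosing M for part (ii): with B = 2^(2k) and c = B!, the weights w m = c/m are exact on
-- 1..B, and H(2m) ≥ H(m) + c/2 gives H(B) ≥ c k; so p H crosses c k at some M ≤ B.
module HarmonicChoice (p k : ℕ) (p≥1 : 1 ≤ p) (k≥1 : 1 ≤ k) where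

  B : ℕ
  B = 2 ^ (k + k)

  c : ℕ
  c = B !

  instance
    c≢0 : NonZero c
    c≢0 = >-nonZero (1≤n! B)

  w : ℕ → ℕ
  w zero    = 0
  w (suc m) = c / suc m

  H : ℕ → ℕ
  H = hsum w

  harmonic : ∀ m → 1 ≤ m → m ≤ B → m * w m ≡ c
  harmonic (suc m) _ m<B = trans (cong (suc m *_) (n/m≡quotient m∣c)) (sym (m∣n⇒n≡m*quotient m∣c))
    where
    m∣c : suc m ∣ c
    m∣c = ∣-trans (m∣m*n (m !)) (m≤n⇒m!∣n! m<B)

  w-anti : ∀ i i' → 1 ≤ i → i ≤ i' → i' ≤ B → w i' ≤ w i
  w-anti i i' i≥1 i≤i' i'≤B with w i' ≤? w i
  ... | yes ok = ok
  ... | no  bad = ⊥-elim (<-irrefl (trans (harmonic i i≥1 (≤-trans i≤i' i'≤B)) (sym (harmonic i' (≤-trans i≥1 i≤i') i'≤B)))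
                    (<-≤-trans (*-monoʳ-< i {{>-nonZero i≥1}} (≰⇒> bad)) (*-monoˡ-≤ (w i') i≤i')))

  -- each of the j terms after H(m) (j ≤ m) is at least w(2m)
  H-tail : ∀ m j → j ≤ m → 1 ≤ m → m + m ≤ B → H m + j * w (m + m) ≤ H (m + j)
  H-tail m zero    _   _   _   = ≤-reflexive (trans (+-identityʳ (H m)) (cong H (sym (+-identityʳ m))))
  H-tail m (suc j) j<m m≥1 2m≤B = begin
    H m + (w (m + m) + j * w (m + m)) ≡⟨ regroup (H m) (w (m + m)) (j * w (m + m)) ⟩
    (H m + j * w (m + m)) + w (m + m) ≤⟨ +-mono-≤ (H-tail m j (≤-trans (n≤1+n j) j<m) m≥1 2m≤B)
        (w-anti (suc (m + j)) (m + m) (s≤s z≤n) (subst (_≤ m + m) (+-suc m j) (+-monoʳ-≤ m j<m)) 2m≤B) ⟩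
    H (m + j) + w (suc (m + j))      ≡⟨ cong H (sym (+-suc m j)) ⟩
    H (m + suc j)                    ∎
    where
    open ≤-Reasoning
    regroup : ∀ a b c → a + (b + c) ≡ a + c + b
    regroup = solve-∀

  H-doubling : ∀ m → 1 ≤ m → m + m ≤ B → c + (H m + H m) ≤ H (m + m) + H (m + m)
  H-doubling m m≥1 2m≤B = begin
    c + (H m + H m)                               ≡⟨ cong (_+ (H m + H m)) (sym (harmonic (m + m) (≤-trans m≥1 (m≤m+n m m)) 2m≤B)) ⟩
    (m + m) * w (m + m) + (H m + H m)             ≡⟨ regroup m (w (m + m)) (H m) ⟩
    (H m + m * w (m + m)) + (H m + m * w (m + m)) ≤⟨ +-mono-≤ tail tail ⟩
    H (m + m) + H (m + m)                         ∎
    where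
    open ≤-Reasoning
    tail = H-tail m m ≤-refl m≥1 2m≤B
    regroup : ∀ m w h → (m + m) * w + (h + h) ≡ (h + m * w) + (h + m * w)
    regroup = solve-∀

  H-powers : ∀ j → j ≤ k + k → j * c ≤ H (2 ^ j) + H (2 ^ j)
  H-powers zero    _ = z≤n
  H-powers (suc j) j<2k = begin
    c + j * c                    ≤⟨ +-monoʳ-≤ c (H-powers j (≤-trans (n≤1+n j) j<2k)) ⟩
    c + (H m + H m)              ≤⟨ H-doubling m (m^n>0 2 j) (subst (_≤ B) (double (2 ^ j)) (^-monoʳ-≤ 2 j<2k)) ⟩
    H (m + m) + H (m + m)        ≡⟨ cong (λ z → H z + H z) (sym (double (2 ^ j))) ⟩
    H (2 ^ suc j) + H (2 ^ suc j) ∎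
    where
    open ≤-Reasoning
    m = 2 ^ j
    double : ∀ x → 2 * x ≡ x + x
    double = solve-∀

  Enough : ℕ → Set
  Enough m = c * k ≤ p * H m

  Enough-B : Enough B
  Enough-B = ≤-trans ck≤H (m≤n*m (H B) p {{>-nonZero p≥1}})
    where
    ck≤H : c * k ≤ H B
    ck≤H = *-cancelˡ-≤ 2 (begin
      2 * (c * k)    ≡⟨ regroup c k ⟩
      (k + k) * c    ≤⟨ H-powers (k + k) ≤-refl ⟩
      H B + H B      ≡⟨ double (H B) ⟨
      2 * H B        ∎)
      where
      open ≤-Reasoning
      regroup : ∀ c k → 2 * (c * k) ≡ (k + k) * c
      regroup = solve-∀
      double : ∀ x → 2 * x ≡ x + x
      double = solve-∀

  not-Enough-0 : ¬ Enough 0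
  not-Enough-0 h = <⇒≱ (*-mono-≤ (1≤n! B) k≥1) (subst (c * k ≤_) (*-zeroʳ p) h)

  threshold : Σ ℕ λ M' → ¬ Enough M' × Enough (suc M') × suc M' ≤ B
  threshold = crossing Enough (λ m → c * k ≤? p * H m) B 0 not-Enough-0 Enough-B

enforcerWins-1q : ∀ q k → 1 ≤ q → 1 ≤ k → ∀ n → suc q ^ k ≤ n → (b : Fin n → ℕ) → (∀ i → 1 ≤ b i) →
  sumFirst (suc q ^ k) b ≤ k * suc q ^ k → EnforcerWinsBoth b 1 q
enforcerWins-1q q k q≥1 k≥1 n N≤n b b≥1 average = planWins b≥1 (fromℕ< (≤-trans (m^n>0 (suc q) k) N≤n))
  where
  E = suc k + ΣF n b
  open PotentialOneQ {n} q q≥1 E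
  open KillingStrategy b 1 q Inv
  b≤E : ∀ i → b i ≤ E
  b≤E i = ≤-trans (ΣF-term≤ n b i) (m≤n+m _ (suc k))
  plan : Plan
  plan = record
    { nonempty = Inv-nonempty
    ; respects = respects
    ; opening  = opening b k k≥1 N≤n b≤E (m≤m+n (suc k) _) average
    ; reply    = reply
    }
  open Play ≤-refl q≥1 plan

corollary1p9-i : (q k : ℕ) → 1 ≤ q → 1 ≤ k →
  ∃ λ N → 1 ≤ N × N ≤ (1 + q) ^ k ×
    ((n : ℕ) → N ≤ n → (b : Fin n → ℕ) → ((i : Fin n) → 1 ≤ b i) → Sorted b →
      sumFirst N b ≤ k * N → EnforcerWinsBoth b 1 q)
corollary1p9-i q k q≥1 k≥1 = suc q ^ k , m^n>0 (suc q) k , ≤-refl ,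
  λ n N≤n b b≥1 _ → enforcerWins-1q q k q≥1 k≥1 n N≤n b b≥1

-- Corollary 1.9 (ii), with N = M + 1 where p H(M - 1) < c k ≤ p H(M) for the harmonic weights
corollary1p9-ii : (p k : ℕ) → 1 ≤ p → 1 ≤ k →
  ∃ λ N → 1 ≤ N × LeOnePlusExp N k p ×
    ((n : ℕ) → N ≤ n → (b : Fin n → ℕ) → ((i : Fin n) → 1 ≤ b i) → Sorted b →
      sumFirst N b ≤ k * N → EnforcerWinsBoth b p 1)
corollary1p9-ii p k p≥1 k≥1 = suc M , s≤s z≤n , inj₂ bound , wins
  where
  open HarmonicChoice p k p≥1 k≥1
  M′ = proj₁ threshold
  M  = suc M′
  M≤B : M ≤ B
  M≤B = proj₂ (proj₂ (proj₂ threshold))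
  bound : LeExp (M ^ p) k
  bound = harmonic⇒LeExp p k c w M′ (λ m m≥1 m≤M′ → harmonic m m≥1 (≤-trans m≤M′ (≤-trans (n≤1+n M′) M≤B)))
            (<⇒≤ (≰⇒> (proj₁ (proj₂ threshold))))
  wins : (n : ℕ) → suc M ≤ n → (b : Fin n → ℕ) → ((i : Fin n) → 1 ≤ b i) → Sorted b →
    sumFirst (suc M) b ≤ k * suc M → EnforcerWinsBoth b p 1
  wins n N≤n b b≥1 _ average = planWins b≥1 (fromℕ< N≤n)
    where
    open PotentialP1 {n} p k c w M (λ m m≥1 m≤M → harmonic m m≥1 (≤-trans m≤M M≤B)) (proj₁ (proj₂ (proj₂ threshold)))
    open KillingStrategy b p 1 Inv
    plan : Plan
    plan = record
      { nonempty = Inv-nonempty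
      ; respects = respects
      ; opening  = opening b (s≤s z≤n) N≤n average
      ; reply    = reply
      }
    open Play p≥1 ≤-refl plan

-- Corollary 1.9.
corollary1p9 :
  ((q k : ℕ) → 1 ≤ q → 1 ≤ k →
    ∃ λ N → 1 ≤ N × N ≤ (1 + q) ^ k ×
      ((n : ℕ) → N ≤ n → (b : Fin n → ℕ) → ((i : Fin n) → 1 ≤ b i) → Sorted b →
        sumFirst N b ≤ k * N → EnforcerWinsBoth b 1 q))
  ×
  ((p k : ℕ) → 1 ≤ p → 1 ≤ k →
    ∃ λ N → 1 ≤ N × LeOnePlusExp N k p ×
      ((n : ℕ) → N ≤ n → (b : Fin n → ℕ) → ((i : Fin n) → 1 ≤ b i) → Sorted b →
        sumFirst N b ≤ k * N → EnforcerWinsBoth b p 1))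
corollary1p9 = corollary1p9-i , corollary1p9-ii
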